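{- Let $\Phi$ be a finite, reduced, irreducible root system, $w\in W$, $\ell_s=|\Phi^s(w)|$, and fix a reduced decomposition of $w$ with the induced order $\prec$ on $\Phi^s(w)$. For $\underline{\delta}=(\delta_\gamma)_{\gamma\in\Phi^s(w)}\in\{0,1\}^{\ell_s}$ let $\varepsilon_{\underline{\delta}}=\varepsilon^{\sum_{\gamma\in\Phi^s(w)}\delta_\gamma\gamma}$. Then for all $f\in F(Q)$, \[ f\,|^{CG}w(\mathrm{\bf x})=\sum_{\underline{\delta}\in\{0,1\}^{\ell_s}}f(w\varepsilon_{\underline{\delta}}\mathrm{\bf x})\prod_{\beta\in\Phi^s(w)}J\Big((-1)^{\langle\beta,\sum_{\gamma\prec\beta}\delta_\gamma\gamma\rangle}\mathrm{\bf x}^\beta,\ \delta_\beta\Big) \] (empty sums are $0$, empty products $1$).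
   Context: $\Phi$ has simple roots $\alpha_1,\dots,\alpha_r$, positive/negative roots $\Phi^\pm$, root lattice $Q$, Weyl group $W$ with simple reflections $\sigma_j$; $\lambda=\sum_jn_j(\lambda)\alpha_j$. $\langle\cdot,\cdot\rangle$ is the $W$-invariant inner product with short roots of squared length $2$; $m_\alpha=2$ if $\langle\alpha,\alpha\rangle/2$ is odd, else $1$; $m_j=m_{\alpha_j}$. $F=\mathbb{Q}(u)$; $F(Q)$ the field of rational functions in $x_j=\mathrm{\bf x}^{\alpha_j}$ with $\mathrm{\bf x}^\lambda=\prod x_j^{n_j(\lambda)}$. For a multivariable $y$: $y^\lambda=\prod y_j^{n_j(\lambda)}$, $wy=(y^{w^{ -1}\alpha_1},\dots,y^{w^{ -1}\alpha_r})$, and for $\mu\in Q$, $\varepsilon^\mu y=((-1)^{\langle\alpha_k,\mu\rangle}y_k)_k$; $\varepsilon_j=\varepsilon^{\alpha_j}$; $f(y)$ is substitution of $y$ for $\mathrm{\bf x}$, and $w\varepsilon y$ means $w$ applied to $\varepsilon y$. $f^\pm_j(\mathrm{\bf x})=\frac12(f(\mathrm{\bf x})\pm f(\varepsilon_j\mathrm{\bf x}))$. The Chinta–Gunnells right action is given by $f|^{CG}\sigma_j(\mathrm{\bf x})=\frac{1-u/x_j}{1-ux_j}f^+_j(\sigma_j\mathrm{\bf x})+x_j^{ -1}f^-_j(\sigma_j\mathrm{\bf x})$ if $m_j=2$ and $f(\sigma_j\mathrm{\bf x})$ if $m_j=1$. $J(x,\delta)=\frac12\big(\frac{1-u/x}{1-ux}+\frac{(-1)^\delta}{x}\big)$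 for $\delta\in\{0,1\}$. $\Phi(w)=\{\alpha\in\Phi^+:w\alpha\in\Phi^-\}$; a reduced decomposition $w=\sigma_{i_\ell}\cdots\sigma_{i_1}$ orders it as $\alpha_{i_1}\prec\sigma_{i_1}(\alpha_{i_2})\prec\dots\prec\sigma_{i_1}\cdots\sigma_{i_{\ell-1}}(\alpha_{i_\ell})$. $\Phi^s(w)=\{\beta\in\Phi(w):m_\beta=2\}$ with the induced order. -}

module Defs where

open import Data.Bool using (Bool; true; false; not; _xor_; if_then_else_)
open import Data.Nat as ℕ using (ℕ; zero; suc)
import Data.Nat.DivMod as ℕD
open import Data.Integer as ℤ using (ℤ; +_; -[1+_]; ∣_∣)
import Data.Integer.DivMod as ℤD
open import Data.Integer.Divisibility as ℤDiv using ()
open import Data.Rational as ℚ using (ℚ; 0ℚ; 1ℚ; ½)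
open import Data.Fin using (Fin; zero; suc)
open import Data.Vec as Vec using (Vec; []; _∷_; lookup; tabulate; zipWith; replicate)
import Data.Vec.Properties as VecP
open import Data.List as List using (List; []; _∷_; _++_; map; foldr; filter; length; concatMap)
open import Data.List.Membership.Propositional using (_∈_)
open import Data.Product using (_×_; _,_; proj₁; proj₂; ∃; ∃-syntax)
open import Data.Sum using (_⊎_)
open import Relation.Nullary using (¬_; does)
open import Relation.Binary.PropositionalEquality using (_≡_; _≢_)

-- Elements of the root lattice Q, written in coordinates w.r.t. the
-- simple roots α_1 … α_n :  λ = Σ_j n_j(λ) α_j  ↦  (n_1(λ), …, n_n(λ)).

Lat : ℕ → Set
Lat n = Vec ℤ n

0L : ∀ {n} → Lat n
0L = replicate _ (+ 0)

_+L_ : ∀ {n} → Lat n → Lat n → Lat n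
_+L_ = zipWith ℤ._+_

_·L_ : ∀ {n} → ℤ → Lat n → Lat n
c ·L v = Vec.map (c ℤ.*_) v

-L_ : ∀ {n} → Lat n → Lat n
-L v = Vec.map ℤ.-_ v

e : ∀ {n} → Fin n → Lat n
e j = tabulate (λ k → if does (j Data.Fin.≟ k) then + 1 else + 0)
  where import Data.Fin

sumℤ : ∀ {n} → Vec ℤ n → ℤ
sumℤ = Vec.foldr _ ℤ._+_ (+ 0)

bil : ∀ {n} → (Fin n → Fin n → ℤ) → Lat n → Lat n → ℤ
bil G v μ = sumℤ (tabulate (λ i → sumℤ (tabulate (λ j →
              lookup v i ℤ.* lookup μ j ℤ.* G i j))))

-- exact integer division (used only where divisibility holds); x / 0 := 0
divℤ : ℤ → ℤ → ℤ
divℤ x (+ zero)  = + 0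
divℤ x (+ suc m) = x ℤD./ℕ suc m
divℤ x -[1+ m ]  = ℤ.- (x ℤD./ℕ suc m)

refl : ∀ {n} → (Fin n → Fin n → ℤ) → Lat n → Lat n → Lat n
refl G β v = v +L ((ℤ.- divℤ (+ 2 ℤ.* bil G v β) (bil G β β)) ·L β)

record RootSystem : Set where
  field
    rank  : ℕ
    gram  : Fin rank → Fin rank → ℤ          -- ⟨α_i , α_j⟩
    roots : List (Lat rank)

  ⟪_,_⟫ : Lat rank → Lat rank → ℤ
  ⟪_,_⟫ = bil gram

  field
    gram-sym    : ∀ i j → gram i j ≡ gram j i
    pos-def     : ∀ (v : Lat rank) → v ≢ 0L → ℤ.+ 0 ℤ.< ⟪ v , v ⟫
    simple∈     : ∀ j → e j ∈ roots
    nonzero     : ∀ {α} → α ∈ roots → α ≢ 0L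
    base        : ∀ {α} → α ∈ roots →
                  (∀ k → ℤ.+ 0 ℤ.≤ lookup α k) ⊎ (∀ k → lookup α k ℤ.≤ ℤ.+ 0)
    crystal     : ∀ {α β} → α ∈ roots → β ∈ roots →
                  ⟪ β , β ⟫ ℤDiv.∣ (+ 2 ℤ.* ⟪ α , β ⟫)
    reflect∈    : ∀ {α β} → α ∈ roots → β ∈ roots → refl gram β α ∈ roots
    reduced     : ∀ {α β} → α ∈ roots → β ∈ roots → ∀ (a b : ℤ) → a ≢ + 0 →
                  a ·L α ≡ b ·L β → (β ≡ α) ⊎ (β ≡ -L α)
    irreducible : ∀ (P : Lat rank → Bool) →
                  (∀ {α β} → α ∈ roots → β ∈ roots → P α ≡ true → P β ≡ false →
                     ⟪ α , β ⟫ ≡ + 0) →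
                  (∀ {α} → α ∈ roots → P α ≡ true) ⊎ (∀ {α} → α ∈ roots → P α ≡ false)
    short-len   : (∃[ α ] (α ∈ roots × ⟪ α , α ⟫ ≡ + 2)) ×
                  (∀ {α} → α ∈ roots → + 2 ℤ.≤ ⟪ α , α ⟫)

module _ (R : RootSystem) where
  open RootSystem R

  private
    n = rank

  σ : Fin n → Lat n → Lat n
  σ j = refl gram (e j)

  -- Words  [i_1 , … , i_ℓ]  stand for  w = σ_{i_ℓ} ⋯ σ_{i_1}.
  Word : Set
  Word = List (Fin n)

  actW : Word → Lat n → Lat n
  actW ws v = List.foldl (λ acc i → σ i acc) v ws

  actWinv : Word → Lat n → Lat n
  actWinv ws v = foldr σ v ws

  -- w = σ_{i_ℓ}⋯σ_{i_1} is a reduced decomposition: no shorter word gives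
  -- the same element of W ⊂ GL(V) (W acts faithfully on Q).
  Reduced : Word → Set
  Reduced ws = ∀ (vs : Word) → (∀ v → actW vs v ≡ actW ws v) →
               length ws ℕ.≤ length vs

  -- Φ(w) in the order  α_{i_1} ≺ σ_{i_1}(α_{i_2}) ≺ … ≺ σ_{i_1}⋯σ_{i_{ℓ-1}}(α_{i_ℓ})
  PhiW : Word → List (Lat n)
  PhiW []       = []
  PhiW (i ∷ is) = e i ∷ map (σ i) (PhiW is)

  -- m_α = 2  iff  ⟨α,α⟩/2 is odd
  m2 : Lat n → Bool
  m2 α = does ((∣ ⟪ α , α ⟫ ∣ ℕD./ 2) ℕD.% 2 ℕ.≟ 1)

  PhiSW : Word → List (Lat n)
  PhiSW ws = filter (λ β → m2 β Data.Bool.≟ true) (PhiW ws)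
    where import Data.Bool

  -- The field F(Q) = ℚ(u)(x_1,…,x_n) = Frac(ℚ[u^{±1}, x_1^{±1},…,x_n^{±1}]).
  -- Laurent polynomials in the n+1 variables (u, x_1, …, x_n): a term
  -- c · u^a · x^λ is stored as (c , a ∷ λ); a polynomial is a finite
  -- list of terms (a formal sum, duplicates allowed).

  Exp : Set
  Exp = Vec ℤ (suc n)

  LPoly : Set
  LPoly = List (ℚ × Exp)

  coeff : LPoly → Exp → ℚ
  coeff p ε = foldr (λ t acc → if does (VecP.≡-dec ℤ._≟_ (proj₂ t) ε)
                                  then proj₁ t ℚ.+ acc else acc) 0ℚ p

  _≈P_ : LPoly → LPoly → Set
  p ≈P q = ∀ ε → coeff p ε ≡ coeff q ε

  0P : LPoly
  0P = []

  cP : ℚ → LPoly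
  cP c = (c , replicate _ (+ 0)) ∷ []

  _+P_ : LPoly → LPoly → LPoly
  _+P_ = _++_

  _*P_ : LPoly → LPoly → LPoly
  p *P q = concatMap (λ s → map (λ t → (proj₁ s ℚ.* proj₁ t , zipWith ℤ._+_ (proj₂ s) (proj₂ t))) q) p

  -P_ : LPoly → LPoly
  -P p = map (λ t → (ℚ.- proj₁ t , proj₂ t)) p

  Frac : Set
  Frac = LPoly × LPoly

  num den : Frac → LPoly
  num = proj₁
  den = proj₂

  _≈F_ : Frac → Frac → Set
  (a , b) ≈F (c , d) = (a *P d) ≈P (c *P b)

  poly : LPoly → Frac
  poly p = (p , cP 1ℚ)

  _+F_ : Frac → Frac → Frac
  (a , b) +F (c , d) = ((a *P d) +P (c *P b) , b *P d)

  _*F_ : Frac → Frac → Frac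
  (a , b) *F (c , d) = (a *P c , b *P d)

  _/F_ : LPoly → LPoly → Frac
  a /F b = (a , b)

  sumF : List Frac → Frac
  sumF = foldr _+F_ (poly 0P)

  -- Points: vectors y = (y_1,…,y_n) of signed Laurent monomials ±x^μ,
  -- stored as (s , μ) with s = true meaning the sign −1.

  SMon : Set
  SMon = Bool × Lat n

  odd : ℤ → Bool
  odd z = does (∣ z ∣ ℕD.% 2 ℕ.≟ 1)

  _*M_ : SMon → SMon → SMon
  (s , μ) *M (t , ν) = (s xor t , μ +L ν)

  1M : SMon
  1M = (false , 0L)

  _^M_ : SMon → ℤ → SMon
  (s , μ) ^M k = ((s Data.Bool.∧ odd k) , k ·L μ)
    where import Data.Bool

  flipM : Bool → SMon → SMon
  flipM b (s , μ) = (b xor s , μ)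

  Point : Set
  Point = Vec SMon n

  xPt : Point
  xPt = tabulate (λ k → (false , e k))

  _^P_ : Point → Lat n → SMon
  y ^P v = Vec.foldr _ _*M_ 1M (zipWith _^M_ y v)

  wPt : Word → Point → Point
  wPt ws y = tabulate (λ k → y ^P actWinv ws (e k))

  epsPt : Lat n → Point → Point
  epsPt μ y = tabulate (λ k → flipM (odd ⟪ e k , μ ⟫) (lookup y k))

  substTerm : Point → ℚ × Exp → ℚ × Exp
  substTerm y (c , a ∷ v) with y ^P v
  ... | (s , μ) = ((if s then ℚ.- c else c) , a ∷ μ)

  substP : Point → LPoly → LPoly
  substP y = map (substTerm y)

  substF : Point → Frac → Frac
  substF y (a , b) = (substP y a , substP y b)

  monP : SMon → LPoly
  monP (s , μ) = ((if s then ℚ.- 1ℚ else 1ℚ) , + 0 ∷ μ) ∷ []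

  uP : LPoly
  uP = (1ℚ , + 1 ∷ 0L) ∷ []

  invM : SMon → SMon
  invM (s , μ) = (s , -L μ)

  ratio : SMon → Frac
  ratio y = (cP 1ℚ +P (-P (uP *P monP (invM y)))) /F (cP 1ℚ +P (-P (uP *P monP y)))

  m2j : Fin n → Bool
  m2j j = m2 (e j)

  half : Frac → Frac
  half f = poly (cP ½) *F f

  cgσ : Fin n → Frac → Frac
  cgσ j f = if m2j j then
      (ratio xj *F fplus) +F (poly (monP (invM xj)) *F fminus)
    else substF σx f
    where
      xj : SMon
      xj = (false , e j)
      σx : Point
      σx = wPt (j ∷ []) xPt
      fσ  = substF σx f
      fεσ = substF (epsPt (e j) σx) f
      fplus  = half (fσ +F fεσ)
      fminus = half (fσ +F (poly (cP (ℚ.- 1ℚ)) *F fεσ))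

  -- f |^{CG} w  for  w = σ_{i_ℓ}⋯σ_{i_1}:  f|σ_{i_ℓ}|σ_{i_{ℓ-1}}|⋯|σ_{i_1}
  cgW : Word → Frac → Frac
  cgW ws f = foldr cgσ f ws

  J : SMon → Bool → Frac
  J y δ = half (ratio y +F poly (monP (flipM δ (invM y))))

  -- all δ ∈ {0,1}^ℓ  (true = 1)
  allBools : ℕ → List (List Bool)
  allBools zero    = [] ∷ []
  allBools (suc k) = map (false ∷_) (allBools k) ++ map (true ∷_) (allBools k)

  epsSum : List (Lat n) → List Bool → Lat n
  epsSum (γ ∷ γs) (d ∷ ds) = (if d then γ +L epsSum γs ds else epsSum γs ds)
  epsSum _        _        = 0L

  -- Π_β J((-1)^{⟨β, Σ_{γ≺β} δ_γ γ⟩} x^β, δ_β), with S = Σ_{γ≺β} δ_γ γ accumulated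
  prodJ : List (Lat n) → List Bool → Lat n → Frac
  prodJ (β ∷ βs) (d ∷ ds) S =
    J (flipM (odd ⟪ β , S ⟫) (false , β)) d *F
    prodJ βs ds (if d then S +L β else S)
  prodJ _        _        S = poly (cP 1ℚ)

  rhs : Word → Frac → Frac
  rhs ws f = sumF (map term (allBools (length Φs)))
    where
      Φs = PhiSW ws
      term : List Bool → Frac
      term δ = substF (wPt ws (epsPt (epsSum Φs δ) xPt)) f *F prodJ Φs δ 0L

-- Induction on the word [i₁ , … , iₗ], for which f|w = (f|w′)|σᵢ₁ and Φ(w) = {αᵢ₁} ∪ σᵢ₁ Φ(w′).
-- When mᵢ = 2 the action of σᵢ regroups as f|σᵢ = J(xᵢ, 0) f(σᵢ x) + J(xᵢ, 1) f(εᵢ σᵢ x), and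
-- σᵢ x and εᵢ σᵢ x are the points σᵢ ε^ν x with ν = 0 and ν = αᵢ. Substituting σᵢ ε^ν x into a
-- summand f(w′ ε^μ x) Π J(±x^β, δ_β) of the expansion for w′ yields f(w ε^{ν + σᵢ μ} x) Π J(±x^{σᵢ β}, δ_β),
-- because ⟨σᵢ u, ν + σᵢ μ⟩ = ⟨σᵢ u, ν⟩ + ⟨u, μ⟩: the two values of ν supply the new sign δ_{αᵢ},
-- and J(xᵢ, δ) is the new factor. When mᵢ = 1 only ν = 0 occurs and αᵢ is not in Φ^s(w).
-- The identities are equalities of rational functions with nonzero denominators; these form a
-- ring because Laurent polynomials have no zero divisors (leading monomials multiply).

module Submission where

open import Defs hiding (refl; Exp; coeff)
open import Algebra.Bundles using (CommutativeRing)
open import Algebra.Consequences.Propositional using (comm∧assoc⇒middleFour)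
open import Algebra.Consequences.Setoid using (comm∧idˡ⇒id; comm∧invˡ⇒inv; comm∧distrˡ⇒distr)
import Algebra.Properties.CommutativeSemigroup as CommutativeSemigroupProperties
import Algebra.Properties.Group as GroupProperties
import Algebra.Properties.Ring as RingProperties
open import Algebra.Solver.Ring.AlmostCommutativeRing using (_-Raw-AlmostCommutative⟶_; fromCommutativeRing; Induced-equivalence)
open import Algebra.Structures using (IsCommutativeRing)
open import Data.Bool.Base using (Bool; true; false; if_then_else_; _xor_; _∧_)
import Data.Bool.Properties as BoolP
open import Data.Fin.Base using (Fin; zero; suc)
open import Data.Integer as ℤ using (ℤ; +_; -[1+_]; ∣_∣; _⊖_)
open import Data.Integer.Divisibility.Signed as ℤ∣ using (divides; ∣ᵤ⇒∣)
import Data.Integer.Properties as ℤP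
open import Data.Integer.Tactic.RingSolver using (solve-∀)
open import Data.List.Base using (List; []; _∷_; _++_; map; foldr; concatMap; filter; length)
open import Data.List.Membership.Propositional using (_∈_)
import Data.List.Properties as ListP
open import Data.List.Relation.Unary.Any using (here; there)
open import Data.Maybe.Base using (just; nothing)
open import Data.Nat as ℕ using (ℕ; zero; suc; parity)
import Data.Nat.DivMod as ℕD
import Data.Nat.Properties as ℕP
open import Data.Parity.Base as ℙ using (Parity; 0ℙ; 1ℙ)
import Data.Parity.Properties as ℙP
open import Data.Product.Base using (Σ; _×_; _,_; proj₁; proj₂)
open import Data.Rational as ℚ using (ℚ; 0ℚ; 1ℚ)
import Data.Rational.Properties as ℚP
open import Data.Rational.Solver using (module +-*-Solver)
open import Data.Sum.Base using (_⊎_; inj₁; inj₂)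
open import Data.Vec.Base as Vec using (Vec; []; _∷_; lookup; tabulate; zipWith; replicate)
import Data.Vec.Properties as VecP
open import Data.Vec.Relation.Binary.Lex.Core using (this; next)
open import Data.Vec.Relation.Binary.Lex.Strict as Lex using (Lex-<)
open import Data.Vec.Relation.Binary.Pointwise.Inductive using (Pointwise-≡⇒≡; ≡⇒Pointwise-≡)
open import Function.Base using (_∘_)
open import Level using (0ℓ)
open import Relation.Binary.Bundles using (Setoid)
open import Relation.Binary.Definitions using (DecidableEquality; WeaklyDecidable; tri<; tri≈; tri>)
open import Relation.Binary.PropositionalEquality hiding (J)
import Relation.Binary.Reasoning.Setoid as SetoidReasoning
open import Relation.Nullary using (¬_; Dec; yes; no; does; ¬?)
open import Relation.Nullary.Decidable using (dec-true; dec-false; decidable-stable)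
open import Relation.Nullary.Negation using (contradiction)

open import Algebra.Properties.Group ℚP.+-0-group using (x∙y⁻¹≈ε⇒x≈y) renaming (⁻¹-involutive to neg-involutive)
open import Algebra.Properties.Semiring.Sum ℤP.+-*-semiring using (sum; sum-syntax; sum-cong-≗; ∑-distrib-+; ∑-comm; *-distribˡ-sum)

module IntegerParity where

  isOdd : ℤ → Bool
  isOdd z = does (∣ z ∣ ℕD.% 2 ℕ.≟ 1)

  toBool : Parity → Bool
  toBool 0ℙ = false
  toBool 1ℙ = true

  toBool-+ : ∀ p q → toBool (p ℙ.+ q) ≡ toBool p xor toBool q
  toBool-+ 0ℙ q  = refl
  toBool-+ 1ℙ 0ℙ = refl
  toBool-+ 1ℙ 1ℙ = refl

  toBool-* : ∀ p q → toBool (p ℙ.* q) ≡ toBool p ∧ toBool q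
  toBool-* 0ℙ q = refl
  toBool-* 1ℙ q = refl

  odd?≡toBool∘parity : ∀ n → does (n ℕD.% 2 ℕ.≟ 1) ≡ toBool (parity n)
  odd?≡toBool∘parity zero          = refl
  odd?≡toBool∘parity (suc zero)    = refl
  odd?≡toBool∘parity (suc (suc n)) = odd?≡toBool∘parity n

  parity-∸ : ∀ {m n} → m ℕ.≤ n → parity (n ℕ.∸ m) ≡ parity n ℙ.+ parity m
  parity-∸ {m} {n} m≤n = begin
    parity (n ℕ.∸ m)                           ≡⟨ sym (ℙP.+-identityʳ _) ⟩
    parity (n ℕ.∸ m) ℙ.+ 0ℙ                    ≡⟨ cong (parity (n ℕ.∸ m) ℙ.+_) (sym (ℙP.p+p≡0ℙ (parity m))) ⟩
    parity (n ℕ.∸ m) ℙ.+ (parity m ℙ.+ parity m) ≡⟨ sym (ℙP.+-assoc (parity (n ℕ.∸ m)) _ _) ⟩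
    parity (n ℕ.∸ m) ℙ.+ parity m ℙ.+ parity m ≡⟨ cong (ℙ._+ parity m) (sym (ℙP.+-homo-+ (n ℕ.∸ m) m)) ⟩
    parity (n ℕ.∸ m ℕ.+ m) ℙ.+ parity m        ≡⟨ cong (λ k → parity k ℙ.+ parity m) (ℕP.m∸n+n≡m m≤n) ⟩
    parity n ℙ.+ parity m                      ∎
    where open ≡-Reasoning

  parity-∣⊖∣ : ∀ m n → parity ∣ m ⊖ n ∣ ≡ parity m ℙ.+ parity n
  parity-∣⊖∣ m n with ℕP.≤-total m n
  ... | inj₁ m≤n = trans (cong parity (ℤP.∣⊖∣-≤ m≤n)) (trans (parity-∸ m≤n) (ℙP.+-comm (parity n) (parity m)))
  ... | inj₂ n≤m = trans (cong parity (ℤP.∣m⊖n∣≡∣n⊖m∣ m n)) (trans (cong parity (ℤP.∣⊖∣-≤ n≤m)) (parity-∸ n≤m))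

  parityℤ : ℤ → Parity
  parityℤ z = parity ∣ z ∣

  parityℤ-+ : ∀ a b → parityℤ (a ℤ.+ b) ≡ parityℤ a ℙ.+ parityℤ b
  parityℤ-+ (+ m)    (+ n)    = ℙP.+-homo-+ m n
  parityℤ-+ (+ m)    -[1+ n ] = parity-∣⊖∣ m (suc n)
  parityℤ-+ -[1+ m ] (+ n)    = trans (parity-∣⊖∣ n (suc m)) (ℙP.+-comm (parity n) _)
  parityℤ-+ -[1+ m ] -[1+ n ] = trans (cong (parity ∘ suc) (sym (ℕP.+-suc m n))) (ℙP.+-homo-+ (suc m) (suc n))

  parityℤ-* : ∀ a b → parityℤ (a ℤ.* b) ≡ parityℤ a ℙ.* parityℤ b
  parityℤ-* a b = trans (cong parity (ℤP.abs-* a b)) (ℙP.*-homo-* ∣ a ∣ ∣ b ∣)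

  isOdd≡toBool∘parityℤ : ∀ z → isOdd z ≡ toBool (parityℤ z)
  isOdd≡toBool∘parityℤ z = odd?≡toBool∘parity ∣ z ∣

  isOdd-+ : ∀ a b → isOdd (a ℤ.+ b) ≡ isOdd a xor isOdd b
  isOdd-+ a b = begin
    isOdd (a ℤ.+ b)                          ≡⟨ isOdd≡toBool∘parityℤ (a ℤ.+ b) ⟩
    toBool (parityℤ (a ℤ.+ b))               ≡⟨ cong toBool (parityℤ-+ a b) ⟩
    toBool (parityℤ a ℙ.+ parityℤ b)         ≡⟨ toBool-+ (parityℤ a) (parityℤ b) ⟩
    toBool (parityℤ a) xor toBool (parityℤ b) ≡⟨ sym (cong₂ _xor_ (isOdd≡toBool∘parityℤ a) (isOdd≡toBool∘parityℤ b)) ⟩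
    isOdd a xor isOdd b                      ∎
    where open ≡-Reasoning

  isOdd-* : ∀ a b → isOdd (a ℤ.* b) ≡ isOdd a ∧ isOdd b
  isOdd-* a b = begin
    isOdd (a ℤ.* b)                          ≡⟨ isOdd≡toBool∘parityℤ (a ℤ.* b) ⟩
    toBool (parityℤ (a ℤ.* b))               ≡⟨ cong toBool (parityℤ-* a b) ⟩
    toBool (parityℤ a ℙ.* parityℤ b)         ≡⟨ toBool-* (parityℤ a) (parityℤ b) ⟩
    toBool (parityℤ a) ∧ toBool (parityℤ b)  ≡⟨ sym (cong₂ _∧_ (isOdd≡toBool∘parityℤ a) (isOdd≡toBool∘parityℤ b)) ⟩
    isOdd a ∧ isOdd b                        ∎
    where open ≡-Reasoning

  isOdd-neg : ∀ a → isOdd (ℤ.- a) ≡ isOdd a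
  isOdd-neg a = cong (λ n → does (n ℕD.% 2 ℕ.≟ 1)) (ℤP.∣-i∣≡∣i∣ a)


p≢0∧q≢0⇒p*q≢0 : ∀ {p q} → p ≢ 0ℚ → q ≢ 0ℚ → p ℚ.* q ≢ 0ℚ
p≢0∧q≢0⇒p*q≢0 {p} {q} p≢0 q≢0 pq≡0 = q≢0 (begin
  q                     ≡⟨ sym (ℚP.*-identityˡ q) ⟩
  1ℚ ℚ.* q              ≡⟨ cong (ℚ._* q) (sym (ℚP.*-inverseˡ p)) ⟩
  p⁻¹ ℚ.* p ℚ.* q       ≡⟨ ℚP.*-assoc p⁻¹ p q ⟩
  p⁻¹ ℚ.* (p ℚ.* q)     ≡⟨ cong (p⁻¹ ℚ.*_) pq≡0 ⟩
  p⁻¹ ℚ.* 0ℚ            ≡⟨ ℚP.*-zeroʳ p⁻¹ ⟩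
  0ℚ                    ∎)
  where
    open ≡-Reasoning
    instance _ = ℚ.≢-nonZero p≢0
    p⁻¹ : ℚ
    p⁻¹ = ℚ.1/ p

module LaurentPolynomials (m : ℕ) where

  Exp : Set
  Exp = Vec ℤ m

  Poly : Set
  Poly = List (ℚ × Exp)

  _≟ₑ_ : DecidableEquality Exp
  _≟ₑ_ = VecP.≡-dec ℤ._≟_

  infixl 6 _+ₑ_
  infix 4 _<ₑ_ _≤ₑ_

  _+ₑ_ : Exp → Exp → Exp
  _+ₑ_ = zipWith ℤ._+_

  0ₑ : Exp
  0ₑ = replicate m (+ 0)

  coeff : Poly → Exp → ℚ
  coeff p ε = foldr (λ t acc → if does (proj₂ t ≟ₑ ε) then proj₁ t ℚ.+ acc else acc) 0ℚ p

  infix 4 _≈_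
  record _≈_ (p q : Poly) : Set where
    constructor coeffwise
    field coeff-≡ : ∀ ε → coeff p ε ≡ coeff q ε
  open _≈_ public

  infixl 6 _+_
  infixl 7 _*_
  infix 8 -_

  _+_ : Poly → Poly → Poly
  _+_ = _++_

  _*_ : Poly → Poly → Poly
  p * q = concatMap (λ s → map (λ t → (proj₁ s ℚ.* proj₁ t , proj₂ s +ₑ proj₂ t)) q) p

  -_ : Poly → Poly
  - p = map (λ t → (ℚ.- proj₁ t , proj₂ t)) p

  0ₚ : Poly
  0ₚ = []

  const : ℚ → Poly
  const c = (c , 0ₑ) ∷ []

  1ₚ : Poly
  1ₚ = const 1ℚ

  -- Coefficients are pairings with the indicators δ ε, and pairing is linear in both arguments,
  -- so the ring laws below reduce to identities between finite sums in ℚ.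
  pairing : (Exp → ℚ) → Poly → ℚ
  pairing h []            = 0ℚ
  pairing h ((c , e) ∷ p) = c ℚ.* h e ℚ.+ pairing h p

  δ : Exp → Exp → ℚ
  δ ε e = if does (e ≟ₑ ε) then 1ℚ else 0ℚ

  open +-*-Solver using (solve; _:+_; _:*_; :-_; _:=_)
  open ≡-Reasoning

  coeff≡pairing-δ : ∀ p ε → coeff p ε ≡ pairing (δ ε) p
  coeff≡pairing-δ []            ε = refl
  coeff≡pairing-δ ((c , e) ∷ p) ε with e ≟ₑ ε
  ... | yes _ = cong₂ ℚ._+_ (sym (ℚP.*-identityʳ c)) (coeff≡pairing-δ p ε)
  ... | no _  = trans (coeff≡pairing-δ p ε) (sym (trans (cong (ℚ._+ pairing (δ ε) p) (ℚP.*-zeroʳ c)) (ℚP.+-identityˡ _)))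

  pairing-++ : ∀ h p q → pairing h (p ++ q) ≡ pairing h p ℚ.+ pairing h q
  pairing-++ h []            q = sym (ℚP.+-identityˡ _)
  pairing-++ h ((c , e) ∷ p) q =
    trans (cong (c ℚ.* h e ℚ.+_) (pairing-++ h p q)) (sym (ℚP.+-assoc (c ℚ.* h e) _ _))

  pairing-neg : ∀ h p → pairing h (- p) ≡ ℚ.- pairing h p
  pairing-neg h []            = refl
  pairing-neg h ((c , e) ∷ p) = trans (cong (ℚ.- c ℚ.* h e ℚ.+_) (pairing-neg h p))
    (solve 3 (λ c x y → (:- c) :* x :+ (:- y) := :- (c :* x :+ y)) refl c (h e) (pairing h p))

  pairing-negʰ : ∀ h p → pairing (λ e → ℚ.- h e) p ≡ ℚ.- pairing h p
  pairing-negʰ h []            = refl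
  pairing-negʰ h ((c , e) ∷ p) = trans (cong (c ℚ.* ℚ.- h e ℚ.+_) (pairing-negʰ h p))
    (solve 3 (λ c x y → c :* (:- x) :+ (:- y) := :- (c :* x :+ y)) refl c (h e) (pairing h p))

  pairing-cong : ∀ {h g} p → (∀ e → h e ≡ g e) → pairing h p ≡ pairing g p
  pairing-cong []            h≗g = refl
  pairing-cong ((c , e) ∷ p) h≗g = cong₂ (λ a b → c ℚ.* a ℚ.+ b) (h≗g e) (pairing-cong p h≗g)

  pairing-+ : ∀ h g p → pairing (λ e → h e ℚ.+ g e) p ≡ pairing h p ℚ.+ pairing g p
  pairing-+ h g []            = sym (ℚP.+-identityˡ _)
  pairing-+ h g ((c , e) ∷ p) = trans (cong (c ℚ.* (h e ℚ.+ g e) ℚ.+_) (pairing-+ h g p))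
    (solve 5 (λ c x y a b → c :* (x :+ y) :+ (a :+ b) := (c :* x :+ a) :+ (c :* y :+ b))
       refl c (h e) (g e) (pairing h p) (pairing g p))

  pairing-scale : ∀ a h p → pairing (λ e → a ℚ.* h e) p ≡ a ℚ.* pairing h p
  pairing-scale a h []            = sym (ℚP.*-zeroʳ a)
  pairing-scale a h ((c , e) ∷ p) = trans (cong (c ℚ.* (a ℚ.* h e) ℚ.+_) (pairing-scale a h p))
    (solve 4 (λ a c x y → c :* (a :* x) :+ a :* y := a :* (c :* x :+ y)) refl a c (h e) (pairing h p))

  pairing-zero : ∀ p → pairing (λ _ → 0ℚ) p ≡ 0ℚ
  pairing-zero []            = refl
  pairing-zero ((c , e) ∷ p) = trans (cong₂ ℚ._+_ (ℚP.*-zeroʳ c) (pairing-zero p)) (ℚP.+-identityˡ 0ℚ)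

  pairing-* : ∀ h p q → pairing h (p * q) ≡ pairing (λ e → pairing (λ e′ → h (e +ₑ e′)) q) p
  pairing-* h []            q = refl
  pairing-* h ((c , e) ∷ p) q = trans (pairing-++ h (map (λ t → (c ℚ.* proj₁ t , e +ₑ proj₂ t)) q) (p * q)) (cong₂ ℚ._+_ (row q) (pairing-* h p q))
    where
      row : ∀ q → pairing h (map (λ t → (c ℚ.* proj₁ t , e +ₑ proj₂ t)) q)
                ≡ c ℚ.* pairing (λ e′ → h (e +ₑ e′)) q
      row []             = sym (ℚP.*-zeroʳ c)
      row ((d , e′) ∷ q) = trans (cong (c ℚ.* d ℚ.* h (e +ₑ e′) ℚ.+_) (row q))
        (solve 4 (λ c d x y → c :* d :* x :+ c :* y := c :* (d :* x :+ y))
           refl c d (h (e +ₑ e′)) (pairing (λ e″ → h (e +ₑ e″)) q))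

  pairing-swap : ∀ (H : Exp → Exp → ℚ) p q →
                 pairing (λ e → pairing (H e) q) p ≡ pairing (λ e′ → pairing (λ e → H e e′) p) q
  pairing-swap H []            q = sym (pairing-zero q)
  pairing-swap H ((c , e) ∷ p) q = begin
    c ℚ.* pairing (H e) q ℚ.+ pairing (λ e → pairing (H e) q) p
      ≡⟨ cong₂ ℚ._+_ (sym (pairing-scale c (H e) q)) (pairing-swap H p q) ⟩
    pairing (λ e′ → c ℚ.* H e e′) q ℚ.+ pairing (λ e′ → pairing (λ e → H e e′) p) q
      ≡⟨ sym (pairing-+ _ _ q) ⟩
    pairing (λ e′ → c ℚ.* H e e′ ℚ.+ pairing (λ e → H e e′) p) q ∎

  _without_ : Poly → Exp → Poly
  p without e₀ = filter (λ t → ¬? (proj₂ t ≟ₑ e₀)) p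

  pairing-split : ∀ h e₀ p → pairing h p ≡ h e₀ ℚ.* coeff p e₀ ℚ.+ pairing h (p without e₀)
  pairing-split h e₀ []            = sym (trans (ℚP.+-identityʳ _) (ℚP.*-zeroʳ (h e₀)))
  pairing-split h e₀ ((c , e) ∷ p) with e ≟ₑ e₀
  ... | yes refl = trans (cong (c ℚ.* h e ℚ.+_) (pairing-split h e p))
    (solve 4 (λ c x a b → c :* x :+ (x :* a :+ b) := x :* (c :+ a) :+ b) refl c (h e) (coeff p e) _)
  ... | no _     = trans (cong (c ℚ.* h e ℚ.+_) (pairing-split h e₀ p))
    (solve 3 (λ x a b → x :+ (a :+ b) := a :+ (x :+ b)) refl (c ℚ.* h e) (h e₀ ℚ.* coeff p e₀) _)

  coeff-without-self : ∀ e₀ p → coeff (p without e₀) e₀ ≡ 0ℚ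
  coeff-without-self e₀ []            = refl
  coeff-without-self e₀ ((c , e) ∷ p) with e ≟ₑ e₀
  ... | yes _ = coeff-without-self e₀ p
  ... | no e≢e₀ rewrite dec-false (e ≟ₑ e₀) e≢e₀ = coeff-without-self e₀ p

  coeff-without-other : ∀ {e₀ ε} p → ε ≢ e₀ → coeff (p without e₀) ε ≡ coeff p ε
  coeff-without-other []            ε≢e₀ = refl
  coeff-without-other {e₀} {ε} ((c , e) ∷ p) ε≢e₀ with e ≟ₑ e₀
  ... | yes refl rewrite dec-false (e ≟ₑ ε) (ε≢e₀ ∘ sym) = coeff-without-other p ε≢e₀
  ... | no _ with does (e ≟ₑ ε)
  ...   | true  = cong (c ℚ.+_) (coeff-without-other p ε≢e₀)
  ...   | false = coeff-without-other p ε≢e₀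

  pairing-vanishes : ∀ h p → (∀ e → h e ℚ.* coeff p e ≡ 0ℚ) → pairing h p ≡ 0ℚ
  pairing-vanishes h p = go (length p) p ℕP.≤-refl
    where
      -- Recursion on a length bound: p without e₀ is shorter than p but not a subterm of it.
      go : ∀ n p → length p ℕ.≤ n → (∀ e → h e ℚ.* coeff p e ≡ 0ℚ) → pairing h p ≡ 0ℚ
      go _       []            _          _     = refl
      go (suc n) ((c , e₀) ∷ p) (ℕ.s≤s ∣p∣≤n) hp = begin
        pairing h ((c , e₀) ∷ p)                          ≡⟨ pairing-split h e₀ ((c , e₀) ∷ p) ⟩
        h e₀ ℚ.* coeff ((c , e₀) ∷ p) e₀ ℚ.+ pairing h rest ≡⟨ cong₂ ℚ._+_ (hp e₀) (go n rest shorter hrest) ⟩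
        0ℚ ℚ.+ 0ℚ                                          ≡⟨ ℚP.+-identityˡ 0ℚ ⟩
        0ℚ                                                 ∎
        where
          rest : Poly
          rest = ((c , e₀) ∷ p) without e₀
          shorter : length rest ℕ.≤ n
          shorter rewrite dec-true (e₀ ≟ₑ e₀) refl = ℕP.≤-trans (ListP.length-filter _ p) ∣p∣≤n
          hrest : ∀ e → h e ℚ.* coeff rest e ≡ 0ℚ
          hrest e with e ≟ₑ e₀
          ... | yes refl = trans (cong (h e ℚ.*_) (coeff-without-self e ((c , e) ∷ p))) (ℚP.*-zeroʳ (h e))
          ... | no e≢e₀  = trans (cong (h e ℚ.*_) (coeff-without-other ((c , e₀) ∷ p) e≢e₀)) (hp e)


  pairing-supported : ∀ h g p → (∀ e → coeff p e ≢ 0ℚ → h e ≡ g e) → pairing h p ≡ pairing g p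
  pairing-supported h g p h≗g = x∙y⁻¹≈ε⇒x≈y (pairing h p) (pairing g p) (begin
    pairing h p ℚ.- pairing g p               ≡⟨ cong (pairing h p ℚ.+_) (sym (pairing-negʰ g p)) ⟩
    pairing h p ℚ.+ pairing (λ e → ℚ.- g e) p ≡⟨ sym (pairing-+ h _ p) ⟩
    pairing (λ e → h e ℚ.- g e) p             ≡⟨ pairing-vanishes _ p vanish ⟩
    0ℚ                                        ∎)
    where
      vanish : ∀ e → (h e ℚ.- g e) ℚ.* coeff p e ≡ 0ℚ
      vanish e with coeff p e ℚP.≟ 0ℚ
      ... | yes c≡0 = trans (cong ((h e ℚ.- g e) ℚ.*_) c≡0) (ℚP.*-zeroʳ (h e ℚ.- g e))
      ... | no c≢0  = trans (cong (λ x → (x ℚ.- g e) ℚ.* coeff p e) (h≗g e c≢0))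
                            (trans (cong (ℚ._* coeff p e) (ℚP.+-inverseʳ (g e))) (ℚP.*-zeroˡ (coeff p e)))

  coeff-+ : ∀ p q ε → coeff (p + q) ε ≡ coeff p ε ℚ.+ coeff q ε
  coeff-+ p q ε = begin
    coeff (p ++ q) ε                       ≡⟨ coeff≡pairing-δ (p ++ q) ε ⟩
    pairing (δ ε) (p ++ q)                 ≡⟨ pairing-++ (δ ε) p q ⟩
    pairing (δ ε) p ℚ.+ pairing (δ ε) q    ≡⟨ sym (cong₂ ℚ._+_ (coeff≡pairing-δ p ε) (coeff≡pairing-δ q ε)) ⟩
    coeff p ε ℚ.+ coeff q ε                ∎

  coeff-neg : ∀ p ε → coeff (- p) ε ≡ ℚ.- coeff p ε
  coeff-neg p ε = begin
    coeff (- p) ε          ≡⟨ coeff≡pairing-δ (- p) ε ⟩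
    pairing (δ ε) (- p)    ≡⟨ pairing-neg (δ ε) p ⟩
    ℚ.- pairing (δ ε) p    ≡⟨ cong ℚ.-_ (sym (coeff≡pairing-δ p ε)) ⟩
    ℚ.- coeff p ε          ∎

  coeff-* : ∀ p q ε → coeff (p * q) ε ≡ pairing (λ e → pairing (λ e′ → δ ε (e +ₑ e′)) q) p
  coeff-* p q ε = trans (coeff≡pairing-δ (p * q) ε) (pairing-* (δ ε) p q)

  pairing-resp-≈ : ∀ h {p q} → p ≈ q → pairing h p ≡ pairing h q
  pairing-resp-≈ h {p} {q} (coeffwise p≈q) = x∙y⁻¹≈ε⇒x≈y (pairing h p) (pairing h q) (begin
    pairing h p ℚ.- pairing h q     ≡⟨ cong (pairing h p ℚ.+_) (sym (pairing-neg h q)) ⟩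
    pairing h p ℚ.+ pairing h (- q) ≡⟨ sym (pairing-++ h p (- q)) ⟩
    pairing h (p + - q)             ≡⟨ pairing-vanishes h (p + - q) vanish ⟩
    0ℚ                              ∎)
    where
      vanish : ∀ e → h e ℚ.* coeff (p + - q) e ≡ 0ℚ
      vanish e = begin
        h e ℚ.* coeff (p + - q) e               ≡⟨ cong (h e ℚ.*_) (coeff-+ p (- q) e) ⟩
        h e ℚ.* (coeff p e ℚ.+ coeff (- q) e)   ≡⟨ cong (λ x → h e ℚ.* (x ℚ.+ coeff (- q) e)) (p≈q e) ⟩
        h e ℚ.* (coeff q e ℚ.+ coeff (- q) e)   ≡⟨ cong (λ x → h e ℚ.* (coeff q e ℚ.+ x)) (coeff-neg q e) ⟩
        h e ℚ.* (coeff q e ℚ.- coeff q e)       ≡⟨ cong (h e ℚ.*_) (ℚP.+-inverseʳ (coeff q e)) ⟩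
        h e ℚ.* 0ℚ                              ≡⟨ ℚP.*-zeroʳ (h e) ⟩
        0ℚ                                      ∎

  +ₑ-comm : ∀ a b → a +ₑ b ≡ b +ₑ a
  +ₑ-comm = VecP.zipWith-comm ℤP.+-comm

  +ₑ-assoc : ∀ a b c → (a +ₑ b) +ₑ c ≡ a +ₑ (b +ₑ c)
  +ₑ-assoc = VecP.zipWith-assoc ℤP.+-assoc

  +ₑ-identityˡ : ∀ a → 0ₑ +ₑ a ≡ a
  +ₑ-identityˡ = VecP.zipWith-identityˡ ℤP.+-identityˡ

  ≈-refl : ∀ {p} → p ≈ p
  ≈-refl = coeffwise λ _ → refl

  ≈-sym : ∀ {p q} → p ≈ q → q ≈ p
  ≈-sym (coeffwise p≈q) = coeffwise λ ε → sym (p≈q ε)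

  ≈-trans : ∀ {p q r} → p ≈ q → q ≈ r → p ≈ r
  ≈-trans (coeffwise p≈q) (coeffwise q≈r) = coeffwise λ ε → trans (p≈q ε) (q≈r ε)

  +-cong : ∀ {p p′ q q′} → p ≈ p′ → q ≈ q′ → p + q ≈ p′ + q′
  +-cong {p} {p′} {q} {q′} (coeffwise p≈p′) (coeffwise q≈q′) = coeffwise λ ε →
    trans (coeff-+ p q ε) (trans (cong₂ ℚ._+_ (p≈p′ ε) (q≈q′ ε)) (sym (coeff-+ p′ q′ ε)))

  +-assoc : ∀ p q r → (p + q) + r ≈ p + (q + r)
  +-assoc p q r = coeffwise λ ε → cong (λ s → coeff s ε) (ListP.++-assoc p q r)

  +-identityˡ : ∀ p → 0ₚ + p ≈ p
  +-identityˡ p = ≈-refl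

  +-comm : ∀ p q → p + q ≈ q + p
  +-comm p q = coeffwise λ ε →
    trans (coeff-+ p q ε) (trans (ℚP.+-comm (coeff p ε) (coeff q ε)) (sym (coeff-+ q p ε)))

  -‿inverseˡ : ∀ p → - p + p ≈ 0ₚ
  -‿inverseˡ p = coeffwise λ ε →
    trans (coeff-+ (- p) p ε) (trans (cong (ℚ._+ coeff p ε) (coeff-neg p ε)) (ℚP.+-inverseˡ (coeff p ε)))

  -‿cong : ∀ {p q} → p ≈ q → - p ≈ - q
  -‿cong {p} {q} (coeffwise p≈q) = coeffwise λ ε →
    trans (coeff-neg p ε) (trans (cong ℚ.-_ (p≈q ε)) (sym (coeff-neg q ε)))

  *-cong : ∀ {p p′ q q′} → p ≈ p′ → q ≈ q′ → p * q ≈ p′ * q′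
  *-cong {p} {p′} {q} {q′} p≈p′ q≈q′ = coeffwise λ ε → begin
    coeff (p * q) ε                                             ≡⟨ coeff-* p q ε ⟩
    pairing (λ e → pairing (λ e′ → δ ε (e +ₑ e′)) q) p          ≡⟨ pairing-resp-≈ _ p≈p′ ⟩
    pairing (λ e → pairing (λ e′ → δ ε (e +ₑ e′)) q) p′         ≡⟨ pairing-cong p′ (λ e → pairing-resp-≈ _ q≈q′) ⟩
    pairing (λ e → pairing (λ e′ → δ ε (e +ₑ e′)) q′) p′        ≡⟨ sym (coeff-* p′ q′ ε) ⟩
    coeff (p′ * q′) ε                                           ∎

  *-comm : ∀ p q → p * q ≈ q * p
  *-comm p q = coeffwise λ ε → begin
    coeff (p * q) ε                                       ≡⟨ coeff-* p q ε ⟩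
    pairing (λ e → pairing (λ e′ → δ ε (e +ₑ e′)) q) p    ≡⟨ pairing-swap (λ e e′ → δ ε (e +ₑ e′)) p q ⟩
    pairing (λ e′ → pairing (λ e → δ ε (e +ₑ e′)) p) q    ≡⟨ pairing-cong q (λ e′ → pairing-cong p (λ e → cong (δ ε) (+ₑ-comm e e′))) ⟩
    pairing (λ e′ → pairing (λ e → δ ε (e′ +ₑ e)) p) q    ≡⟨ sym (coeff-* q p ε) ⟩
    coeff (q * p) ε                                       ∎

  *-assoc : ∀ p q r → (p * q) * r ≈ p * (q * r)
  *-assoc p q r = coeffwise λ ε → begin
    coeff ((p * q) * r) ε
      ≡⟨ coeff-* (p * q) r ε ⟩
    pairing (λ e → pairing (λ e″ → δ ε (e +ₑ e″)) r) (p * q)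
      ≡⟨ pairing-* _ p q ⟩
    pairing (λ a → pairing (λ b → pairing (λ c → δ ε ((a +ₑ b) +ₑ c)) r) q) p
      ≡⟨ pairing-cong p (λ a → pairing-cong q (λ b → pairing-cong r (λ c → cong (δ ε) (+ₑ-assoc a b c)))) ⟩
    pairing (λ a → pairing (λ b → pairing (λ c → δ ε (a +ₑ (b +ₑ c))) r) q) p
      ≡⟨ sym (pairing-cong p (λ a → pairing-* (λ d → δ ε (a +ₑ d)) q r)) ⟩
    pairing (λ a → pairing (λ d → δ ε (a +ₑ d)) (q * r)) p
      ≡⟨ sym (coeff-* p (q * r) ε) ⟩
    coeff (p * (q * r)) ε ∎

  *-identityˡ : ∀ p → 1ₚ * p ≈ p
  *-identityˡ p = coeffwise λ ε → begin
    coeff (1ₚ * p) ε                                             ≡⟨ coeff-* 1ₚ p ε ⟩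
    1ℚ ℚ.* pairing (λ e′ → δ ε (0ₑ +ₑ e′)) p ℚ.+ 0ℚ             ≡⟨ ℚP.+-identityʳ _ ⟩
    1ℚ ℚ.* pairing (λ e′ → δ ε (0ₑ +ₑ e′)) p                    ≡⟨ ℚP.*-identityˡ _ ⟩
    pairing (λ e′ → δ ε (0ₑ +ₑ e′)) p                           ≡⟨ pairing-cong p (λ e′ → cong (δ ε) (+ₑ-identityˡ e′)) ⟩
    pairing (δ ε) p                                              ≡⟨ sym (coeff≡pairing-δ p ε) ⟩
    coeff p ε                                                    ∎

  *-distribˡ-+ : ∀ p q r → p * (q + r) ≈ p * q + p * r
  *-distribˡ-+ p q r = coeffwise λ ε → begin
    coeff (p * (q + r)) ε
      ≡⟨ coeff-* p (q + r) ε ⟩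
    pairing (λ e → pairing (λ e′ → δ ε (e +ₑ e′)) (q ++ r)) p
      ≡⟨ pairing-cong p (λ e → pairing-++ _ q r) ⟩
    pairing (λ e → pairing (λ e′ → δ ε (e +ₑ e′)) q ℚ.+ pairing (λ e′ → δ ε (e +ₑ e′)) r) p
      ≡⟨ pairing-+ _ _ p ⟩
    pairing (λ e → pairing (λ e′ → δ ε (e +ₑ e′)) q) p ℚ.+ pairing (λ e → pairing (λ e′ → δ ε (e +ₑ e′)) r) p
      ≡⟨ sym (cong₂ ℚ._+_ (coeff-* p q ε) (coeff-* p r ε)) ⟩
    coeff (p * q) ε ℚ.+ coeff (p * r) ε
      ≡⟨ sym (coeff-+ (p * q) (p * r) ε) ⟩
    coeff (p * q + p * r) ε ∎

  ≈-setoid : Setoid 0ℓ 0ℓ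
  ≈-setoid = record { Carrier = Poly ; _≈_ = _≈_ ; isEquivalence = record { refl = ≈-refl ; sym = ≈-sym ; trans = ≈-trans } }

  isCommutativeRing : IsCommutativeRing _≈_ _+_ _*_ -_ 0ₚ 1ₚ
  isCommutativeRing = record
    { isRing = record
      { +-isAbelianGroup = record
        { isGroup = record
          { isMonoid = record
            { isSemigroup = record
              { isMagma  = record { isEquivalence = Setoid.isEquivalence ≈-setoid ; ∙-cong = +-cong }
              ; assoc    = +-assoc }
            ; identity   = comm∧idˡ⇒id ≈-setoid +-comm +-identityˡ }
          ; inverse      = comm∧invˡ⇒inv ≈-setoid +-comm -‿inverseˡ
          ; ⁻¹-cong      = -‿cong }
        ; comm           = +-comm }
      ; *-cong           = *-cong
      ; *-assoc          = *-assoc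
      ; *-identity       = comm∧idˡ⇒id ≈-setoid *-comm *-identityˡ
      ; distrib          = comm∧distrˡ⇒distr ≈-setoid +-cong *-comm *-distribˡ-+ }
    ; *-comm             = *-comm }

  ring : CommutativeRing 0ℓ 0ℓ
  ring = record { isCommutativeRing = isCommutativeRing }

  private
    module R = CommutativeRing ring
    module RP = RingProperties R.ring
    module +G = GroupProperties R.+-group

  _<ₑ_ : Exp → Exp → Set
  _<ₑ_ = Lex-< _≡_ ℤ._<_

  _≤ₑ_ : Exp → Exp → Set
  a ≤ₑ b = a <ₑ b ⊎ a ≡ b

  <ₑ-irrefl : ∀ {a} → ¬ a <ₑ a
  <ₑ-irrefl = Lex.<-irrefl ℤP.<-irrefl (≡⇒Pointwise-≡ refl)

  <ₑ-trans : ∀ {a b c} → a <ₑ b → b <ₑ c → a <ₑ c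
  <ₑ-trans = Lex.<-trans (record { sym = sym ; trans = trans }) (resp₂ ℤ._<_) ℤP.<-trans

  <ₑ-cmp : ∀ a b → a <ₑ b ⊎ a ≡ b ⊎ b <ₑ a
  <ₑ-cmp a b with Lex.<-cmp sym ℤP.<-cmp a b
  ... | tri< a<b _ _ = inj₁ a<b
  ... | tri≈ _ a≋b _ = inj₂ (inj₁ (Pointwise-≡⇒≡ a≋b))
  ... | tri> _ _ b<a = inj₂ (inj₂ b<a)

  ≤ₑ-<ₑ-trans : ∀ {a b c} → a ≤ₑ b → b <ₑ c → a <ₑ c
  ≤ₑ-<ₑ-trans (inj₁ a<b) b<c = <ₑ-trans a<b b<c
  ≤ₑ-<ₑ-trans (inj₂ refl) b<c = b<c

  +ₑ-monoˡ-< : ∀ {a b} c → a <ₑ b → a +ₑ c <ₑ b +ₑ c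
  +ₑ-monoˡ-< = zipWith-+-monoˡ-<
    where
      zipWith-+-monoˡ-< : ∀ {k} {a b : Vec ℤ k} c → Lex-< _≡_ ℤ._<_ a b →
                          Lex-< _≡_ ℤ._<_ (zipWith ℤ._+_ a c) (zipWith ℤ._+_ b c)
      zipWith-+-monoˡ-< (z ∷ c) (this x<y k≡k) = this (ℤP.+-monoˡ-< z x<y) k≡k
      zipWith-+-monoˡ-< (z ∷ c) (next refl a<b) = next refl (zipWith-+-monoˡ-< c a<b)

  +ₑ-monoʳ-< : ∀ c {a b} → a <ₑ b → c +ₑ a <ₑ c +ₑ b
  +ₑ-monoʳ-< c {a} {b} a<b = subst₂ _<ₑ_ (+ₑ-comm a c) (+ₑ-comm b c) (+ₑ-monoˡ-< c a<b)

  Support : Poly → Exp → Set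
  Support p e = coeff p e ≢ 0ℚ

  support⊆exponents : ∀ p {e} → Support p e → e ∈ map proj₂ p
  support⊆exponents []             e∈p = contradiction refl e∈p
  support⊆exponents ((c , e′) ∷ p) {e} e∈p with e′ ≟ₑ e
  ... | yes refl = here refl
  ... | no _     = there (support⊆exponents p e∈p)

  record LeadingTerm (p : Poly) : Set where
    field
      exponent  : Exp
      nonzero   : Support p exponent
      dominates : ∀ e → Support p e → e ≤ₑ exponent

  private
    Dominant : Poly → List Exp → Exp → Set
    Dominant p es mx = Support p mx × (∀ e → e ∈ es → Support p e → e ≤ₑ mx)

    largestAmong : ∀ p es → (∀ e → e ∈ es → ¬ Support p e) ⊎ Σ Exp (Dominant p es)
    largestAmong p []       = inj₁ λ _ ()
    largestAmong p (x ∷ es) with coeff p x ℚP.≟ 0ℚ | largestAmong p es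
    ... | yes x∉ | inj₁ none        = inj₁ λ { e (here refl) → λ e∈ → e∈ x∉ ; e (there e∈es) → none e e∈es }
    ... | yes x∉ | inj₂ (mx , nz , dom) = inj₂ (mx , nz , λ { e (here refl) e∈ → contradiction x∉ e∈
                                                            ; e (there e∈es) → dom e e∈es })
    ... | no x∈  | inj₁ none        = inj₂ (x , x∈ , λ { e (here refl) _ → inj₂ refl
                                                     ; e (there e∈es) e∈ → contradiction e∈ (none e e∈es) })
    ... | no x∈  | inj₂ (mx , nz , dom) with <ₑ-cmp x mx
    ...   | inj₁ x<mx        = inj₂ (mx , nz , λ { e (here refl) _ → inj₁ x<mx ; e (there e∈es) → dom e e∈es })
    ...   | inj₂ (inj₁ refl) = inj₂ (mx , nz , λ { e (here refl) _ → inj₂ refl ; e (there e∈es) → dom e e∈es })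
    ...   | inj₂ (inj₂ mx<x) = inj₂ (x , x∈ , λ { e (here refl) _ → inj₂ refl
                                               ; e (there e∈es) e∈ → inj₁ (≤ₑ-<ₑ-trans (dom e e∈es e∈) mx<x) })

  zero⊎leadingTerm : ∀ p → p ≈ 0ₚ ⊎ LeadingTerm p
  zero⊎leadingTerm p with largestAmong p (map proj₂ p)
  ... | inj₁ none = inj₁ (coeffwise λ e → decidable-stable (coeff p e ℚP.≟ 0ℚ) (λ e∈ → none e (support⊆exponents p e∈) e∈))
  ... | inj₂ (mx , nz , dom) = inj₂ (record { exponent = mx ; nonzero = nz ; dominates = λ e e∈ → dom e (support⊆exponents p e∈) e∈ })

  δ-self : ∀ a → δ a a ≡ 1ℚ
  δ-self a rewrite dec-true (a ≟ₑ a) refl = refl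

  <ₑ⇒δ≡0 : ∀ {a b} → b <ₑ a → δ a b ≡ 0ℚ
  <ₑ⇒δ≡0 {a} {b} b<a rewrite dec-false (b ≟ₑ a) (λ { refl → <ₑ-irrefl b<a }) = refl

  module _ {p q} (P : LeadingTerm p) (Q : LeadingTerm q) where
    open LeadingTerm P renaming (exponent to mp; nonzero to p-mp≢0; dominates to p-dom)
    open LeadingTerm Q renaming (exponent to mq; nonzero to q-mq≢0; dominates to q-dom)

    private
      δ-+ₑ : ∀ {e e′} → e ≤ₑ mp → e′ ≤ₑ mq → δ (mp +ₑ mq) (e +ₑ e′) ≡ δ mp e ℚ.* δ mq e′
      δ-+ₑ (inj₂ refl) (inj₂ refl) = trans (δ-self (mp +ₑ mq)) (sym (cong₂ ℚ._*_ (δ-self mp) (δ-self mq)))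
      δ-+ₑ {e} {e′} (inj₁ e<mp) e′≤mq = trans (<ₑ⇒δ≡0 (sum< e′≤mq)) (sym (trans (cong (ℚ._* δ mq e′) (<ₑ⇒δ≡0 e<mp)) (ℚP.*-zeroˡ (δ mq e′))))
        where
          sum< : e′ ≤ₑ mq → e +ₑ e′ <ₑ mp +ₑ mq
          sum< (inj₁ e′<mq) = <ₑ-trans (+ₑ-monoˡ-< e′ e<mp) (+ₑ-monoʳ-< mp e′<mq)
          sum< (inj₂ refl)  = +ₑ-monoˡ-< e′ e<mp
      δ-+ₑ {e} {e′} (inj₂ refl) (inj₁ e′<mq) =
        trans (<ₑ⇒δ≡0 (+ₑ-monoʳ-< mp e′<mq)) (sym (trans (cong (δ mp mp ℚ.*_) (<ₑ⇒δ≡0 e′<mq)) (ℚP.*-zeroʳ (δ mp mp))))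

    coeff-*-leading : coeff (p * q) (mp +ₑ mq) ≡ coeff p mp ℚ.* coeff q mq
    coeff-*-leading = begin
      coeff (p * q) (mp +ₑ mq)
        ≡⟨ coeff-* p q (mp +ₑ mq) ⟩
      pairing (λ e → pairing (λ e′ → δ (mp +ₑ mq) (e +ₑ e′)) q) p
        ≡⟨ pairing-supported _ _ p (λ e e∈ → inner (p-dom e e∈)) ⟩
      pairing (λ e → coeff q mq ℚ.* δ mp e) p
        ≡⟨ pairing-scale (coeff q mq) (δ mp) p ⟩
      coeff q mq ℚ.* pairing (δ mp) p
        ≡⟨ cong (coeff q mq ℚ.*_) (sym (coeff≡pairing-δ p mp)) ⟩
      coeff q mq ℚ.* coeff p mp
        ≡⟨ ℚP.*-comm (coeff q mq) (coeff p mp) ⟩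
      coeff p mp ℚ.* coeff q mq ∎
      where
        inner : ∀ {e} → e ≤ₑ mp → pairing (λ e′ → δ (mp +ₑ mq) (e +ₑ e′)) q ≡ coeff q mq ℚ.* δ mp e
        inner {e} e≤mp = begin
          pairing (λ e′ → δ (mp +ₑ mq) (e +ₑ e′)) q ≡⟨ pairing-supported _ _ q (λ e′ e′∈ → δ-+ₑ e≤mp (q-dom e′ e′∈)) ⟩
          pairing (λ e′ → δ mp e ℚ.* δ mq e′) q      ≡⟨ pairing-scale (δ mp e) (δ mq) q ⟩
          δ mp e ℚ.* pairing (δ mq) q                ≡⟨ cong (δ mp e ℚ.*_) (sym (coeff≡pairing-δ q mq)) ⟩
          δ mp e ℚ.* coeff q mq                      ≡⟨ ℚP.*-comm (δ mp e) (coeff q mq) ⟩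
          coeff q mq ℚ.* δ mp e                      ∎

    *-leading-nonzero : Support (p * q) (mp +ₑ mq)
    *-leading-nonzero eq = p≢0∧q≢0⇒p*q≢0 p-mp≢0 q-mq≢0 (trans (sym coeff-*-leading) eq)

  *-nonzero : ∀ {p q} → ¬ p ≈ 0ₚ → ¬ q ≈ 0ₚ → ¬ p * q ≈ 0ₚ
  *-nonzero {p} {q} p≉0 q≉0 (coeffwise pq≈0) with zero⊎leadingTerm p | zero⊎leadingTerm q
  ... | inj₁ p≈0 | _        = p≉0 p≈0
  ... | inj₂ _   | inj₁ q≈0 = q≉0 q≈0
  ... | inj₂ P   | inj₂ Q   = *-leading-nonzero P Q (pq≈0 _)

  ≈0? : ∀ p → Dec (p ≈ 0ₚ)
  ≈0? p with zero⊎leadingTerm p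
  ... | inj₁ p≈0 = yes p≈0
  ... | inj₂ P   = no λ (coeffwise p≈0) → LeadingTerm.nonzero P (p≈0 _)

  *-cancelˡ : ∀ {d x y} → ¬ d ≈ 0ₚ → d * x ≈ d * y → x ≈ y
  *-cancelˡ {d} {x} {y} d≉0 dx≈dy with ≈0? (x R.- y)
  ... | yes x-y≈0 = +G.x∙y⁻¹≈ε⇒x≈y x y x-y≈0
  ... | no x-y≉0  = contradiction (≈-trans (RP.x[y-z]≈xy-xz d x y) (+G.x≈y⇒x∙y⁻¹≈ε dx≈dy))
                                  (*-nonzero d≉0 x-y≉0)

  coeff-const : ∀ c ε → coeff (const c) ε ≡ (if does (0ₑ ≟ₑ ε) then c else 0ℚ)
  coeff-const c ε with does (0ₑ ≟ₑ ε)
  ... | true  = ℚP.+-identityʳ c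
  ... | false = refl

  const-homomorphism : ℚP.+-*-rawRing -Raw-AlmostCommutative⟶ fromCommutativeRing ring
  const-homomorphism = record
    { ⟦_⟧    = const
    ; +-homo = λ x y → coeffwise λ ε → begin
        coeff (const (x ℚ.+ y)) ε                    ≡⟨ coeff-const (x ℚ.+ y) ε ⟩
        ite (does (0ₑ ≟ₑ ε)) (x ℚ.+ y)               ≡⟨ ite-+ (does (0ₑ ≟ₑ ε)) x y ⟩
        ite (does (0ₑ ≟ₑ ε)) x ℚ.+ ite (does (0ₑ ≟ₑ ε)) y
          ≡⟨ sym (cong₂ ℚ._+_ (coeff-const x ε) (coeff-const y ε)) ⟩
        coeff (const x) ε ℚ.+ coeff (const y) ε      ≡⟨ sym (coeff-+ (const x) (const y) ε) ⟩
        coeff (const x + const y) ε                  ∎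
    ; *-homo = λ x y → coeffwise λ ε → cong (λ e → coeff ((x ℚ.* y , e) ∷ []) ε) (sym (+ₑ-identityˡ 0ₑ))
    ; -‿homo = λ _ → ≈-refl
    ; 0-homo = coeffwise λ ε → trans (coeff-const 0ℚ ε) (ite-0 (does (0ₑ ≟ₑ ε)))
    ; 1-homo = ≈-refl }
    where
      ite : Bool → ℚ → ℚ
      ite b c = if b then c else 0ℚ
      ite-+ : ∀ b x y → ite b (x ℚ.+ y) ≡ ite b x ℚ.+ ite b y
      ite-+ true  x y = refl
      ite-+ false x y = sym (ℚP.+-identityˡ 0ℚ)
      ite-0 : ∀ b → ite b 0ℚ ≡ 0ℚ
      ite-0 true  = refl
      ite-0 false = refl

module ℚAlgebraSolver (R : CommutativeRing 0ℓ 0ℓ)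
                      (ι : ℚP.+-*-rawRing -Raw-AlmostCommutative⟶ fromCommutativeRing R) where
  open CommutativeRing R using (reflexive)
  open _-Raw-AlmostCommutative⟶_ ι using (⟦_⟧)

  private
    agree? : WeaklyDecidable (Induced-equivalence ι)
    agree? x y with x ℚP.≟ y
    ... | yes x≡y = just (reflexive (cong ⟦_⟧ x≡y))
    ... | no _    = nothing

  open import Algebra.Solver.Ring ℚP.+-*-rawRing (fromCommutativeRing R) ι agree? public

module RationalFunctions (m : ℕ) where
  open LaurentPolynomials m
    using (Poly; _≈_; coeffwise; 0ₑ; _≟ₑ_; 0ₚ; 1ₚ; const; coeff-const; *-nonzero; *-cancelˡ; const-homomorphism)
    renaming (_+_ to _+ₚ_; _*_ to _*ₚ_; -_ to -ₚ_; ring to polyRing)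
  private
    module P = CommutativeRing polyRing
  open ℚAlgebraSolver polyRing const-homomorphism

  record RatFun : Set where
    constructor _/_∣_
    field
      numerator denominator : Poly
      denominator≉0         : ¬ denominator ≈ 0ₚ
  open RatFun public

  infix 4 _≃_
  record _≃_ (r s : RatFun) : Set where
    constructor cross
    field cross-≈ : numerator r *ₚ denominator s ≈ numerator s *ₚ denominator r
  open _≃_ public

  1≉0 : ¬ 1ₚ ≈ 0ₚ
  1≉0 (coeffwise 1≈0) = ℚP.1≢0 (trans (sym (trans (coeff-const 1ℚ 0ₑ) (cong (λ b → if b then 1ℚ else 0ℚ) (dec-true (0ₑ ≟ₑ 0ₑ) refl)))) (1≈0 0ₑ))

  infixl 6 _+_
  infixl 7 _*_
  infix 8 -_

  _+_ : RatFun → RatFun → RatFun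
  (a / b ∣ b≉0) + (c / d ∣ d≉0) = (a *ₚ d +ₚ c *ₚ b) / b *ₚ d ∣ *-nonzero b≉0 d≉0

  _*_ : RatFun → RatFun → RatFun
  (a / b ∣ b≉0) * (c / d ∣ d≉0) = (a *ₚ c) / b *ₚ d ∣ *-nonzero b≉0 d≉0

  -_ : RatFun → RatFun
  - (a / b ∣ b≉0) = (-ₚ a) / b ∣ b≉0

  polynomial : Poly → RatFun
  polynomial p = p / 1ₚ ∣ 1≉0

  0ʳ 1ʳ : RatFun
  0ʳ = polynomial 0ₚ
  1ʳ = polynomial 1ₚ

  private
    open SetoidReasoning P.setoid

    *-congʳ : ∀ c {a b} → a ≈ b → a *ₚ c ≈ b *ₚ c
    *-congʳ c a≈b = P.*-cong a≈b (P.refl {c})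

  ≃-refl : ∀ {r} → r ≃ r
  ≃-refl = cross P.refl

  ≃-sym : ∀ {r s} → r ≃ s → s ≃ r
  ≃-sym (cross eq) = cross (P.sym eq)

  -- Transitivity is where the denominators must be nonzero: cancel d from d·(a·f) ≈ d·(e·b).
  ≃-trans : ∀ {r s t} → r ≃ s → s ≃ t → r ≃ t
  ≃-trans {a / b ∣ _} {c / d ∣ d≉0} {e / f ∣ _} (cross ad≈cb) (cross cf≈ed) = cross (*-cancelˡ d≉0 (begin
    d *ₚ (a *ₚ f)   ≈⟨ solve 3 (λ d a f → d :* (a :* f) := (a :* d) :* f) P.refl d a f ⟩
    (a *ₚ d) *ₚ f   ≈⟨ *-congʳ f ad≈cb ⟩
    (c *ₚ b) *ₚ f   ≈⟨ solve 3 (λ c b f → (c :* b) :* f := (c :* f) :* b) P.refl c b f ⟩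
    (c *ₚ f) *ₚ b   ≈⟨ *-congʳ b cf≈ed ⟩
    (e *ₚ d) *ₚ b   ≈⟨ solve 3 (λ e d b → (e :* d) :* b := d :* (e :* b)) P.refl e d b ⟩
    d *ₚ (e *ₚ b)   ∎))

  +-cong : ∀ {r r′ s s′} → r ≃ r′ → s ≃ s′ → r + s ≃ r′ + s′
  +-cong {a / b ∣ _} {a′ / b′ ∣ _} {c / d ∣ _} {c′ / d′ ∣ _} (cross ab′≈a′b) (cross cd′≈c′d) = cross (begin
    (a *ₚ d +ₚ c *ₚ b) *ₚ (b′ *ₚ d′)
      ≈⟨ solve 6 (λ a b c d b′ d′ → (a :* d :+ c :* b) :* (b′ :* d′) := (a :* b′) :* (d :* d′) :+ (c :* d′) :* (b :* b′))
           P.refl a b c d b′ d′ ⟩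
    (a *ₚ b′) *ₚ (d *ₚ d′) +ₚ (c *ₚ d′) *ₚ (b *ₚ b′)
      ≈⟨ P.+-cong (*-congʳ (d *ₚ d′) ab′≈a′b) (*-congʳ (b *ₚ b′) cd′≈c′d) ⟩
    (a′ *ₚ b) *ₚ (d *ₚ d′) +ₚ (c′ *ₚ d) *ₚ (b *ₚ b′)
      ≈⟨ solve 6 (λ a′ b c′ d b′ d′ → (a′ :* b) :* (d :* d′) :+ (c′ :* d) :* (b :* b′) := (a′ :* d′ :+ c′ :* b′) :* (b :* d))
           P.refl a′ b c′ d b′ d′ ⟩
    (a′ *ₚ d′ +ₚ c′ *ₚ b′) *ₚ (b *ₚ d) ∎)

  *-cong : ∀ {r r′ s s′} → r ≃ r′ → s ≃ s′ → r * s ≃ r′ * s′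
  *-cong {a / b ∣ _} {a′ / b′ ∣ _} {c / d ∣ _} {c′ / d′ ∣ _} (cross ab′≈a′b) (cross cd′≈c′d) = cross (begin
    (a *ₚ c) *ₚ (b′ *ₚ d′)   ≈⟨ solve 4 (λ a c b′ d′ → (a :* c) :* (b′ :* d′) := (a :* b′) :* (c :* d′)) P.refl a c b′ d′ ⟩
    (a *ₚ b′) *ₚ (c *ₚ d′)   ≈⟨ P.*-cong ab′≈a′b cd′≈c′d ⟩
    (a′ *ₚ b) *ₚ (c′ *ₚ d)   ≈⟨ solve 4 (λ a′ b c′ d → (a′ :* b) :* (c′ :* d) := (a′ :* c′) :* (b :* d)) P.refl a′ b c′ d ⟩
    (a′ *ₚ c′) *ₚ (b *ₚ d)   ∎)

  -‿cong : ∀ {r s} → r ≃ s → - r ≃ - s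
  -‿cong {a / b ∣ _} {a′ / b′ ∣ _} (cross ab′≈a′b) = cross (begin
    (-ₚ a) *ₚ b′    ≈⟨ solve 2 (λ a b′ → (:- a) :* b′ := :- (a :* b′)) P.refl a b′ ⟩
    -ₚ (a *ₚ b′)    ≈⟨ P.-‿cong ab′≈a′b ⟩
    -ₚ (a′ *ₚ b)    ≈⟨ solve 2 (λ a′ b → :- (a′ :* b) := (:- a′) :* b) P.refl a′ b ⟩
    (-ₚ a′) *ₚ b    ∎)

  +-assoc : ∀ r s t → (r + s) + t ≃ r + (s + t)
  +-assoc (a / b ∣ _) (c / d ∣ _) (e / f ∣ _) = cross (solve 6 (λ a b c d e f →
    ((a :* d :+ c :* b) :* f :+ e :* (b :* d)) :* (b :* (d :* f)) := (a :* (d :* f) :+ (c :* f :+ e :* d) :* b) :* ((b :* d) :* f))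
    P.refl a b c d e f)

  +-comm : ∀ r s → r + s ≃ s + r
  +-comm (a / b ∣ _) (c / d ∣ _) = cross (solve 4 (λ a b c d →
    (a :* d :+ c :* b) :* (d :* b) := (c :* b :+ a :* d) :* (b :* d)) P.refl a b c d)

  +-identityˡ : ∀ r → 0ʳ + r ≃ r
  +-identityˡ (a / b ∣ _) = cross (begin
    (0ₚ *ₚ b +ₚ a *ₚ 1ₚ) *ₚ b   ≈⟨ *-congʳ b (P.+-cong (P.zeroˡ b) (P.*-identityʳ a)) ⟩
    (0ₚ +ₚ a) *ₚ b              ≈⟨ *-congʳ b (P.+-identityˡ a) ⟩
    a *ₚ b                      ≈⟨ P.*-cong (P.refl {a}) (P.sym (P.*-identityˡ b)) ⟩
    a *ₚ (1ₚ *ₚ b)              ∎)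

  -‿inverseˡ : ∀ r → - r + r ≃ 0ʳ
  -‿inverseˡ (a / b ∣ _) = cross (begin
    ((-ₚ a) *ₚ b +ₚ a *ₚ b) *ₚ 1ₚ   ≈⟨ P.*-identityʳ _ ⟩
    (-ₚ a) *ₚ b +ₚ a *ₚ b           ≈⟨ P.+-cong (solve 2 (λ a b → (:- a) :* b := :- (a :* b)) P.refl a b) P.refl ⟩
    -ₚ (a *ₚ b) +ₚ a *ₚ b           ≈⟨ P.-‿inverseˡ (a *ₚ b) ⟩
    0ₚ                              ≈⟨ P.sym (P.zeroˡ (b *ₚ b)) ⟩
    0ₚ *ₚ (b *ₚ b)                  ∎)

  *-assoc : ∀ r s t → (r * s) * t ≃ r * (s * t)
  *-assoc (a / b ∣ _) (c / d ∣ _) (e / f ∣ _) = cross (solve 6 (λ a b c d e f →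
    ((a :* c) :* e) :* (b :* (d :* f)) := (a :* (c :* e)) :* ((b :* d) :* f)) P.refl a b c d e f)

  *-comm : ∀ r s → r * s ≃ s * r
  *-comm (a / b ∣ _) (c / d ∣ _) = cross (solve 4 (λ a b c d →
    (a :* c) :* (d :* b) := (c :* a) :* (b :* d)) P.refl a b c d)

  *-identityˡ : ∀ r → 1ʳ * r ≃ r
  *-identityˡ (a / b ∣ _) = cross (P.*-cong (P.*-identityˡ a) (P.sym (P.*-identityˡ b)))

  *-distribˡ-+ : ∀ r s t → r * (s + t) ≃ r * s + r * t
  *-distribˡ-+ (a / b ∣ _) (c / d ∣ _) (e / f ∣ _) = cross (solve 6 (λ a b c d e f →
    (a :* (c :* f :+ e :* d)) :* ((b :* d) :* (b :* f)) := ((a :* c) :* (b :* f) :+ (a :* e) :* (b :* d)) :* (b :* (d :* f)))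
    P.refl a b c d e f)

  ≃-setoid : Setoid 0ℓ 0ℓ
  ≃-setoid = record { Carrier = RatFun ; _≈_ = _≃_ ; isEquivalence = record { refl = ≃-refl ; sym = ≃-sym ; trans = ≃-trans } }

  isCommutativeRing : IsCommutativeRing _≃_ _+_ _*_ -_ 0ʳ 1ʳ
  isCommutativeRing = record
    { isRing = record
      { +-isAbelianGroup = record
        { isGroup = record
          { isMonoid = record
            { isSemigroup = record
              { isMagma  = record { isEquivalence = Setoid.isEquivalence ≃-setoid ; ∙-cong = +-cong }
              ; assoc    = +-assoc }
            ; identity   = comm∧idˡ⇒id ≃-setoid +-comm {e = 0ʳ} +-identityˡ }
          ; inverse      = comm∧invˡ⇒inv ≃-setoid {_⁻¹ = -_} {e = 0ʳ} +-comm -‿inverseˡ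
          ; ⁻¹-cong      = -‿cong }
        ; comm           = +-comm }
      ; *-cong           = *-cong
      ; *-assoc          = *-assoc
      ; *-identity       = comm∧idˡ⇒id ≃-setoid *-comm {e = 1ʳ} *-identityˡ
      ; distrib          = comm∧distrˡ⇒distr ≃-setoid +-cong *-comm *-distribˡ-+ }
    ; *-comm             = *-comm }

  ring : CommutativeRing 0ℓ 0ℓ
  ring = record { isCommutativeRing = isCommutativeRing }

  constant : ℚ → RatFun
  constant c = polynomial (const c)

  constant-homomorphism : ℚP.+-*-rawRing -Raw-AlmostCommutative⟶ fromCommutativeRing ring
  constant-homomorphism = record
    { ⟦_⟧    = constant
    ; +-homo = λ x y → cross (begin
        const (x ℚ.+ y) *ₚ (1ₚ *ₚ 1ₚ)               ≈⟨ *-congʳ (1ₚ *ₚ 1ₚ) (ι.+-homo x y) ⟩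
        (const x +ₚ const y) *ₚ (1ₚ *ₚ 1ₚ)          ≈⟨ solve 2 (λ X Y → (X :+ Y) :* (con 1ℚ :* con 1ℚ) := (X :* con 1ℚ :+ Y :* con 1ℚ) :* con 1ℚ)
                                                             P.refl (const x) (const y) ⟩
        (const x *ₚ 1ₚ +ₚ const y *ₚ 1ₚ) *ₚ 1ₚ      ∎)
    ; *-homo = λ x y → cross (P.trans (*-congʳ (1ₚ *ₚ 1ₚ) (ι.*-homo x y))
        (solve 2 (λ X Y → (X :* Y) :* (con 1ℚ :* con 1ℚ) := (X :* Y) :* con 1ℚ) P.refl (const x) (const y)))
    ; -‿homo = λ _ → ≃-refl
    ; 0-homo = cross (*-congʳ 1ₚ ι.0-homo)
    ; 1-homo = ≃-refl }
    where module ι = _-Raw-AlmostCommutative⟶_ const-homomorphism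


module Lattice where
  open ≡-Reasoning

  +L-comm : ∀ {n} (u v : Lat n) → u +L v ≡ v +L u
  +L-comm = VecP.zipWith-comm ℤP.+-comm

  +L-assoc : ∀ {n} (u v w : Lat n) → (u +L v) +L w ≡ u +L (v +L w)
  +L-assoc = VecP.zipWith-assoc ℤP.+-assoc

  +L-identityˡ : ∀ {n} (v : Lat n) → 0L +L v ≡ v
  +L-identityˡ = VecP.zipWith-identityˡ ℤP.+-identityˡ

  +L-identityʳ : ∀ {n} (v : Lat n) → v +L 0L ≡ v
  +L-identityʳ = VecP.zipWith-identityʳ ℤP.+-identityʳ

  +L-middle-four : ∀ {n} (u v x y : Lat n) → (u +L v) +L (x +L y) ≡ (u +L x) +L (v +L y)
  +L-middle-four = comm∧assoc⇒middleFour +L-comm +L-assoc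

  ·L-distribˡ : ∀ {n} k (u v : Lat n) → k ·L (u +L v) ≡ (k ·L u) +L (k ·L v)
  ·L-distribˡ k []      []      = refl
  ·L-distribˡ k (x ∷ u) (y ∷ v) = cong₂ _∷_ (ℤP.*-distribˡ-+ k x y) (·L-distribˡ k u v)

  ·L-distribʳ : ∀ {n} a b (v : Lat n) → (a ℤ.+ b) ·L v ≡ (a ·L v) +L (b ·L v)
  ·L-distribʳ a b []      = refl
  ·L-distribʳ a b (x ∷ v) = cong₂ _∷_ (ℤP.*-distribʳ-+ x a b) (·L-distribʳ a b v)

  ·L-assoc : ∀ {n} a b (v : Lat n) → a ·L (b ·L v) ≡ (a ℤ.* b) ·L v
  ·L-assoc a b []      = refl
  ·L-assoc a b (x ∷ v) = cong₂ _∷_ (sym (ℤP.*-assoc a b x)) (·L-assoc a b v)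

  ·L-identity : ∀ {n} (v : Lat n) → (+ 1) ·L v ≡ v
  ·L-identity []      = refl
  ·L-identity (x ∷ v) = cong₂ _∷_ (ℤP.*-identityˡ x) (·L-identity v)

  ·L-zeroˡ : ∀ {n} (v : Lat n) → (+ 0) ·L v ≡ 0L
  ·L-zeroˡ []      = refl
  ·L-zeroˡ (x ∷ v) = cong (+ 0 ∷_) (·L-zeroˡ v)

  ·L-zeroʳ : ∀ {n} k → k ·L (0L {n}) ≡ 0L
  ·L-zeroʳ {zero}  k = refl
  ·L-zeroʳ {suc n} k = cong₂ _∷_ (ℤP.*-zeroʳ k) (·L-zeroʳ {n} k)

  -L≡-1·L : ∀ {n} (v : Lat n) → -L v ≡ ℤ.-1ℤ ·L v
  -L≡-1·L []      = refl
  -L≡-1·L (x ∷ v) = cong₂ _∷_ (sym (ℤP.-1*i≡-i x)) (-L≡-1·L v)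

  e-zero : ∀ {n} → e {suc n} zero ≡ + 1 ∷ 0L
  e-zero {n} = cong (+ 1 ∷_) (trans (VecP.tabulate-allFin _) (VecP.map-const (Vec.allFin n) (+ 0)))

  lattice-induction : ∀ {n} (P : Lat n → Set) → P 0L → (∀ i → P (e i)) →
                      (∀ u v → P u → P v → P (u +L v)) → (∀ k v → P v → P (k ·L v)) → ∀ v → P v
  lattice-induction {zero}  P P0 Pe P+ P· []       = P0
  lattice-induction {suc n} P P0 Pe P+ P· (x ∷ v) = subst P decomposition
      (P+ (x ·L e zero) (+ 0 ∷ v) (P· x (e zero) (Pe zero)) (lattice-induction P′ P0 (Pe ∘ suc) P′+ P′· v))
    where
      P′ : Lat n → Set
      P′ w = P (+ 0 ∷ w)
      P′+ : ∀ u w → P′ u → P′ w → P′ (u +L w)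
      P′+ u w = P+ (+ 0 ∷ u) (+ 0 ∷ w)
      P′· : ∀ k w → P′ w → P′ (k ·L w)
      P′· k w Pw = subst (λ z → P (z ∷ k ·L w)) (ℤP.*-zeroʳ k) (P· k (+ 0 ∷ w) Pw)
      decomposition : (x ·L e zero) +L (+ 0 ∷ v) ≡ x ∷ v
      decomposition = begin
        (x ·L e zero) +L (+ 0 ∷ v)      ≡⟨ cong (λ z → (x ·L z) +L (+ 0 ∷ v)) e-zero ⟩
        (x ℤ.* + 1 ℤ.+ + 0) ∷ ((x ·L 0L) +L v) ≡⟨ cong₂ _∷_ (trans (ℤP.+-identityʳ _) (ℤP.*-identityʳ x))
                                                          (trans (cong (_+L v) (·L-zeroʳ x)) (+L-identityˡ v)) ⟩
        x ∷ v                           ∎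
    
module BilinearForm {n} (G : Fin n → Fin n → ℤ) where
  open ≡-Reasoning
  open Lattice

  sumℤ-tabulate : ∀ {k} (f : Fin k → ℤ) → sumℤ (tabulate f) ≡ sum f
  sumℤ-tabulate {zero}  f = refl
  sumℤ-tabulate {suc k} f = cong (ℤ._+_ (f zero)) (sumℤ-tabulate (f ∘ suc))

  entry : Lat n → Lat n → Fin n → Fin n → ℤ
  entry u v i j = lookup u i ℤ.* lookup v j ℤ.* G i j

  bil≡∑∑ : ∀ u v → bil G u v ≡ ∑[ i < n ] ∑[ j < n ] entry u v i j
  bil≡∑∑ u v = trans (sumℤ-tabulate (λ i → sumℤ (tabulate (entry u v i)))) (sum-cong-≗ (λ i → sumℤ-tabulate (entry u v i)))

  bil-+ˡ : ∀ u v w → bil G (u +L v) w ≡ bil G u w ℤ.+ bil G v w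
  bil-+ˡ u v w = begin
    bil G (u +L v) w                                                              ≡⟨ bil≡∑∑ (u +L v) w ⟩
    ∑[ i < n ] ∑[ j < n ] entry (u +L v) w i j                                     ≡⟨ sum-cong-≗ (λ i → sum-cong-≗ (entry-+ i)) ⟩
    ∑[ i < n ] ∑[ j < n ] (entry u w i j ℤ.+ entry v w i j)                        ≡⟨ sum-cong-≗ (λ i → ∑-distrib-+ (entry u w i) (entry v w i)) ⟩
    ∑[ i < n ] (∑[ j < n ] entry u w i j ℤ.+ ∑[ j < n ] entry v w i j)             ≡⟨ ∑-distrib-+ (λ i → sum (entry u w i)) (λ i → sum (entry v w i)) ⟩
    ∑[ i < n ] ∑[ j < n ] entry u w i j ℤ.+ ∑[ i < n ] ∑[ j < n ] entry v w i j   ≡⟨ sym (cong₂ ℤ._+_ (bil≡∑∑ u w) (bil≡∑∑ v w)) ⟩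
    bil G u w ℤ.+ bil G v w                                                       ∎
    where
      distrib : ∀ a b c g → (a ℤ.+ b) ℤ.* c ℤ.* g ≡ a ℤ.* c ℤ.* g ℤ.+ b ℤ.* c ℤ.* g
      distrib = solve-∀
      entry-+ : ∀ i j → entry (u +L v) w i j ≡ entry u w i j ℤ.+ entry v w i j
      entry-+ i j = trans (cong (λ z → z ℤ.* lookup w j ℤ.* G i j) (VecP.lookup-zipWith ℤ._+_ i u v))
                          (distrib (lookup u i) (lookup v i) (lookup w j) (G i j))

  bil-·ˡ : ∀ k v w → bil G (k ·L v) w ≡ k ℤ.* bil G v w
  bil-·ˡ k v w = begin
    bil G (k ·L v) w                                   ≡⟨ bil≡∑∑ (k ·L v) w ⟩
    ∑[ i < n ] ∑[ j < n ] entry (k ·L v) w i j         ≡⟨ sum-cong-≗ (λ i → sum-cong-≗ (entry-· i)) ⟩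
    ∑[ i < n ] ∑[ j < n ] (k ℤ.* entry v w i j)        ≡⟨ sym (sum-cong-≗ (λ i → *-distribˡ-sum k (entry v w i))) ⟩
    ∑[ i < n ] (k ℤ.* ∑[ j < n ] entry v w i j)        ≡⟨ sym (*-distribˡ-sum k (λ i → sum (entry v w i))) ⟩
    k ℤ.* ∑[ i < n ] ∑[ j < n ] entry v w i j          ≡⟨ cong (k ℤ.*_) (sym (bil≡∑∑ v w)) ⟩
    k ℤ.* bil G v w                                    ∎
    where
      assoc : ∀ k a c g → k ℤ.* a ℤ.* c ℤ.* g ≡ k ℤ.* (a ℤ.* c ℤ.* g)
      assoc = solve-∀
      entry-· : ∀ i j → entry (k ·L v) w i j ≡ k ℤ.* entry v w i j
      entry-· i j = trans (cong (λ z → z ℤ.* lookup w j ℤ.* G i j) (VecP.lookup-map i (k ℤ.*_) v))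
                          (assoc k (lookup v i) (lookup w j) (G i j))

  bil-sym : (∀ i j → G i j ≡ G j i) → ∀ u v → bil G u v ≡ bil G v u
  bil-sym G-sym u v = begin
    bil G u v                                   ≡⟨ bil≡∑∑ u v ⟩
    ∑[ i < n ] ∑[ j < n ] entry u v i j         ≡⟨ ∑-comm (entry u v) ⟩
    ∑[ j < n ] ∑[ i < n ] entry u v i j         ≡⟨ sum-cong-≗ (λ j → sum-cong-≗ (λ i → entry-swap i j)) ⟩
    ∑[ j < n ] ∑[ i < n ] entry v u j i         ≡⟨ sym (bil≡∑∑ v u) ⟩
    bil G v u                                   ∎
    where
      entry-swap : ∀ i j → entry u v i j ≡ entry v u j i
      entry-swap i j = cong₂ ℤ._*_ (ℤP.*-comm (lookup u i) (lookup v j)) (G-sym i j)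

divℤ-exact : ∀ q k → divℤ (q ℤ.* + suc k) (+ suc k) ≡ q
divℤ-exact (+ q)    k rewrite sym (ℤP.pos-* q (suc k)) = cong +_ (ℕD.m*n/n≡m q (suc k))
divℤ-exact -[1+ q ] k rewrite ℕD.m*n%n≡0 (suc q) (suc k) {{_}} = cong (ℤ.-_ ∘ +_) (ℕD.m*n/n≡m (suc q) (suc k))

module Reflections (R : RootSystem) where
  open ≡-Reasoning
  open RootSystem R
  open Lattice
  open BilinearForm gram using (bil-+ˡ; bil-·ˡ; bil-sym)

  private
    *-left-comm : ∀ a b c → a ℤ.* (b ℤ.* c) ≡ b ℤ.* (a ℤ.* c)
    *-left-comm = solve-∀

  ⟪⟫-sym : ∀ u v → ⟪ u , v ⟫ ≡ ⟪ v , u ⟫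
  ⟪⟫-sym = bil-sym gram-sym

  ⟪⟫-+ˡ : ∀ u v w → ⟪ u +L v , w ⟫ ≡ ⟪ u , w ⟫ ℤ.+ ⟪ v , w ⟫
  ⟪⟫-+ˡ = bil-+ˡ

  ⟪⟫-·ˡ : ∀ k v w → ⟪ k ·L v , w ⟫ ≡ k ℤ.* ⟪ v , w ⟫
  ⟪⟫-·ˡ = bil-·ˡ

  ⟪⟫-+ʳ : ∀ w u v → ⟪ w , u +L v ⟫ ≡ ⟪ w , u ⟫ ℤ.+ ⟪ w , v ⟫
  ⟪⟫-+ʳ w u v = trans (⟪⟫-sym w (u +L v)) (trans (⟪⟫-+ˡ u v w) (cong₂ ℤ._+_ (⟪⟫-sym u w) (⟪⟫-sym v w)))

  ⟪⟫-0ʳ : ∀ w → ⟪ w , 0L ⟫ ≡ + 0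
  ⟪⟫-0ʳ w = begin
    ⟪ w , 0L ⟫             ≡⟨ ⟪⟫-sym w 0L ⟩
    ⟪ 0L , w ⟫             ≡⟨ cong ⟪_, w ⟫ (sym (·L-zeroˡ 0L)) ⟩
    ⟪ (+ 0) ·L 0L , w ⟫    ≡⟨ ⟪⟫-·ˡ (+ 0) 0L w ⟩
    + 0 ℤ.* ⟪ 0L , w ⟫     ≡⟨ ℤP.*-zeroˡ ⟪ 0L , w ⟫ ⟩
    + 0                    ∎

  ∣αⱼ∣² : Fin rank → ℤ
  ∣αⱼ∣² j = ⟪ e j , e j ⟫

  ∣αⱼ∣²-positive : ∀ j → Σ ℕ (λ k → ∣αⱼ∣² j ≡ + suc k)
  ∣αⱼ∣²-positive j with ∣αⱼ∣² j | pos-def (e j) (nonzero (simple∈ j))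
  ... | + suc k | _        = k , refl
  ... | + 0     | ℤ.+<+ ()

  cartan : Fin rank → Lat rank → ℤ
  cartan j u = divℤ (+ 2 ℤ.* ⟪ u , e j ⟫) (∣αⱼ∣² j)

  cartan-unique : ∀ j u q → + 2 ℤ.* ⟪ u , e j ⟫ ≡ q ℤ.* ∣αⱼ∣² j → cartan j u ≡ q
  cartan-unique j u q eq with ∣αⱼ∣²-positive j
  ... | k , ∣αⱼ∣²≡ = trans (cong₂ divℤ (trans eq (cong (q ℤ.*_) ∣αⱼ∣²≡)) ∣αⱼ∣²≡) (divℤ-exact q k)

  -- Crystallographic divisibility on simple roots spreads to the whole lattice by linearity.
  ∣αⱼ∣²-divides : ∀ j u → ∣αⱼ∣² j ℤ∣.∣ (+ 2 ℤ.* ⟪ u , e j ⟫)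
  ∣αⱼ∣²-divides j = lattice-induction (λ u → ∣αⱼ∣² j ℤ∣.∣ (+ 2 ℤ.* ⟪ u , e j ⟫))
    (divides (+ 0) (trans (cong (+ 2 ℤ.*_) (trans (⟪⟫-sym 0L (e j)) (⟪⟫-0ʳ (e j)))) (sym (ℤP.*-zeroˡ (∣αⱼ∣² j)))))
    (λ i → ∣ᵤ⇒∣ (crystal (simple∈ i) (simple∈ j)))
    (λ u v ∣u ∣v → subst (∣αⱼ∣² j ℤ∣.∣_) (sym (trans (cong (+ 2 ℤ.*_) (⟪⟫-+ˡ u v (e j))) (ℤP.*-distribˡ-+ (+ 2) ⟪ u , e j ⟫ ⟪ v , e j ⟫)))
                         (ℤ∣.∣m∣n⇒∣m+n ∣u ∣v))
    (λ k v ∣v → subst (∣αⱼ∣² j ℤ∣.∣_) (sym (trans (cong (+ 2 ℤ.*_) (⟪⟫-·ˡ k v (e j))) (*-left-comm (+ 2) k ⟪ v , e j ⟫)))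
                      (ℤ∣.∣n⇒∣m*n k ∣v))

  cartan-exact : ∀ j u → cartan j u ℤ.* ∣αⱼ∣² j ≡ + 2 ℤ.* ⟪ u , e j ⟫
  cartan-exact j u with ∣αⱼ∣²-divides j u
  ... | divides q eq = trans (cong (ℤ._* ∣αⱼ∣² j) (cartan-unique j u q eq)) (sym eq)

  cartan-+ : ∀ j u v → cartan j (u +L v) ≡ cartan j u ℤ.+ cartan j v
  cartan-+ j u v = cartan-unique j (u +L v) _ (begin
    + 2 ℤ.* ⟪ u +L v , e j ⟫                               ≡⟨ cong (+ 2 ℤ.*_) (⟪⟫-+ˡ u v (e j)) ⟩
    + 2 ℤ.* (⟪ u , e j ⟫ ℤ.+ ⟪ v , e j ⟫)                  ≡⟨ ℤP.*-distribˡ-+ (+ 2) ⟪ u , e j ⟫ ⟪ v , e j ⟫ ⟩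
    + 2 ℤ.* ⟪ u , e j ⟫ ℤ.+ + 2 ℤ.* ⟪ v , e j ⟫            ≡⟨ sym (cong₂ ℤ._+_ (cartan-exact j u) (cartan-exact j v)) ⟩
    cartan j u ℤ.* ∣αⱼ∣² j ℤ.+ cartan j v ℤ.* ∣αⱼ∣² j      ≡⟨ sym (ℤP.*-distribʳ-+ (∣αⱼ∣² j) (cartan j u) (cartan j v)) ⟩
    (cartan j u ℤ.+ cartan j v) ℤ.* ∣αⱼ∣² j                ∎)

  cartan-· : ∀ j k u → cartan j (k ·L u) ≡ k ℤ.* cartan j u
  cartan-· j k u = cartan-unique j (k ·L u) _ (begin
    + 2 ℤ.* ⟪ k ·L u , e j ⟫          ≡⟨ cong (+ 2 ℤ.*_) (⟪⟫-·ˡ k u (e j)) ⟩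
    + 2 ℤ.* (k ℤ.* ⟪ u , e j ⟫)       ≡⟨ *-left-comm (+ 2) k ⟪ u , e j ⟫ ⟩
    k ℤ.* (+ 2 ℤ.* ⟪ u , e j ⟫)       ≡⟨ cong (k ℤ.*_) (sym (cartan-exact j u)) ⟩
    k ℤ.* (cartan j u ℤ.* ∣αⱼ∣² j)    ≡⟨ sym (ℤP.*-assoc k (cartan j u) (∣αⱼ∣² j)) ⟩
    k ℤ.* cartan j u ℤ.* ∣αⱼ∣² j      ∎)

  σ-+ : ∀ j u v → σ R j (u +L v) ≡ σ R j u +L σ R j v
  σ-+ j u v = begin
    (u +L v) +L ((ℤ.- cartan j (u +L v)) ·L e j)
      ≡⟨ cong (λ c → (u +L v) +L ((ℤ.- c) ·L e j)) (cartan-+ j u v) ⟩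
    (u +L v) +L ((ℤ.- (cartan j u ℤ.+ cartan j v)) ·L e j)
      ≡⟨ cong (λ c → (u +L v) +L (c ·L e j)) (ℤP.neg-distrib-+ (cartan j u) (cartan j v)) ⟩
    (u +L v) +L ((ℤ.- cartan j u ℤ.+ ℤ.- cartan j v) ·L e j)
      ≡⟨ cong ((u +L v) +L_) (·L-distribʳ (ℤ.- cartan j u) (ℤ.- cartan j v) (e j)) ⟩
    (u +L v) +L (((ℤ.- cartan j u) ·L e j) +L ((ℤ.- cartan j v) ·L e j))
      ≡⟨ +L-middle-four u v _ _ ⟩
    σ R j u +L σ R j v ∎

  σ-· : ∀ j k u → σ R j (k ·L u) ≡ k ·L σ R j u
  σ-· j k u = begin
    (k ·L u) +L ((ℤ.- cartan j (k ·L u)) ·L e j)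
      ≡⟨ cong (λ c → (k ·L u) +L ((ℤ.- c) ·L e j)) (cartan-· j k u) ⟩
    (k ·L u) +L ((ℤ.- (k ℤ.* cartan j u)) ·L e j)
      ≡⟨ cong (λ c → (k ·L u) +L (c ·L e j)) (ℤP.neg-distribʳ-* k (cartan j u)) ⟩
    (k ·L u) +L ((k ℤ.* ℤ.- cartan j u) ·L e j)
      ≡⟨ cong ((k ·L u) +L_) (sym (·L-assoc k (ℤ.- cartan j u) (e j))) ⟩
    (k ·L u) +L (k ·L ((ℤ.- cartan j u) ·L e j))
      ≡⟨ sym (·L-distribˡ k u _) ⟩
    k ·L σ R j u ∎

  σ-0L : ∀ j → σ R j 0L ≡ 0L
  σ-0L j = begin
    σ R j 0L                ≡⟨ cong (σ R j) (sym (·L-zeroˡ 0L)) ⟩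
    σ R j ((+ 0) ·L 0L)     ≡⟨ σ-· j (+ 0) 0L ⟩
    (+ 0) ·L σ R j 0L       ≡⟨ ·L-zeroˡ _ ⟩
    0L                      ∎

  ⟪σ⟫ˡ : ∀ j u w → ⟪ σ R j u , w ⟫ ≡ ⟪ u , w ⟫ ℤ.- cartan j u ℤ.* ⟪ e j , w ⟫
  ⟪σ⟫ˡ j u w = begin
    ⟪ u +L ((ℤ.- cartan j u) ·L e j) , w ⟫          ≡⟨ ⟪⟫-+ˡ u _ w ⟩
    ⟪ u , w ⟫ ℤ.+ ⟪ (ℤ.- cartan j u) ·L e j , w ⟫   ≡⟨ cong (ℤ._+_ ⟪ u , w ⟫) (⟪⟫-·ˡ (ℤ.- cartan j u) (e j) w) ⟩
    ⟪ u , w ⟫ ℤ.+ ℤ.- cartan j u ℤ.* ⟪ e j , w ⟫    ≡⟨ cong (ℤ._+_ ⟪ u , w ⟫) (sym (ℤP.neg-distribˡ-* (cartan j u) ⟪ e j , w ⟫)) ⟩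
    ⟪ u , w ⟫ ℤ.- cartan j u ℤ.* ⟪ e j , w ⟫        ∎

  ⟪σ,αⱼ⟫ : ∀ j u → ⟪ σ R j u , e j ⟫ ≡ ℤ.- ⟪ u , e j ⟫
  ⟪σ,αⱼ⟫ j u = begin
    ⟪ σ R j u , e j ⟫                            ≡⟨ ⟪σ⟫ˡ j u (e j) ⟩
    ⟪ u , e j ⟫ ℤ.- cartan j u ℤ.* ∣αⱼ∣² j       ≡⟨ cong (λ x → ⟪ u , e j ⟫ ℤ.- x) (cartan-exact j u) ⟩
    ⟪ u , e j ⟫ ℤ.- + 2 ℤ.* ⟪ u , e j ⟫          ≡⟨ x-2x≡-x ⟪ u , e j ⟫ ⟩
    ℤ.- ⟪ u , e j ⟫                              ∎
    where
      x-2x≡-x : ∀ x → x ℤ.- + 2 ℤ.* x ≡ ℤ.- x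
      x-2x≡-x = solve-∀

  σ-involutive : ∀ j u → σ R j (σ R j u) ≡ u
  σ-involutive j u = begin
    σ R j u +L ((ℤ.- cartan j (σ R j u)) ·L e j)                       ≡⟨ cong (λ c → σ R j u +L ((ℤ.- c) ·L e j)) cartan-σ ⟩
    (u +L (c′ ·L e j)) +L ((ℤ.- c′) ·L e j)                             ≡⟨ +L-assoc u _ _ ⟩
    u +L ((c′ ·L e j) +L ((ℤ.- c′) ·L e j))                             ≡⟨ cong (u +L_) (sym (·L-distribʳ c′ (ℤ.- c′) (e j))) ⟩
    u +L ((c′ ℤ.+ ℤ.- c′) ·L e j)                                       ≡⟨ cong (λ c → u +L (c ·L e j)) (ℤP.+-inverseʳ c′) ⟩
    u +L ((+ 0) ·L e j)                                                 ≡⟨ cong (u +L_) (·L-zeroˡ (e j)) ⟩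
    u +L 0L                                                             ≡⟨ +L-identityʳ u ⟩
    u                                                                   ∎
    where
      c′ : ℤ
      c′ = ℤ.- cartan j u
      cartan-σ : cartan j (σ R j u) ≡ c′
      cartan-σ = cartan-unique j (σ R j u) _ (begin
        + 2 ℤ.* ⟪ σ R j u , e j ⟫          ≡⟨ cong (+ 2 ℤ.*_) (⟪σ,αⱼ⟫ j u) ⟩
        + 2 ℤ.* ℤ.- ⟪ u , e j ⟫            ≡⟨ sym (ℤP.neg-distribʳ-* (+ 2) ⟪ u , e j ⟫) ⟩
        ℤ.- (+ 2 ℤ.* ⟪ u , e j ⟫)          ≡⟨ cong ℤ.-_ (sym (cartan-exact j u)) ⟩
        ℤ.- (cartan j u ℤ.* ∣αⱼ∣² j)       ≡⟨ ℤP.neg-distribˡ-* (cartan j u) (∣αⱼ∣² j) ⟩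
        c′ ℤ.* ∣αⱼ∣² j                     ∎)

  σ-injective : ∀ j {u v} → σ R j u ≡ σ R j v → u ≡ v
  σ-injective j {u} {v} eq = trans (sym (σ-involutive j u)) (trans (cong (σ R j) eq) (σ-involutive j v))

  cartan-swap : ∀ j u v → cartan j v ℤ.* ⟪ u , e j ⟫ ≡ cartan j u ℤ.* ⟪ v , e j ⟫
  cartan-swap j u v = ℤP.*-cancelˡ-≡ (+ 2) _ _ (begin
    + 2 ℤ.* (cartan j v ℤ.* ⟪ u , e j ⟫)     ≡⟨ *-left-comm (+ 2) (cartan j v) ⟪ u , e j ⟫ ⟩
    cartan j v ℤ.* (+ 2 ℤ.* ⟪ u , e j ⟫)     ≡⟨ cong (cartan j v ℤ.*_) (sym (cartan-exact j u)) ⟩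
    cartan j v ℤ.* (cartan j u ℤ.* ∣αⱼ∣² j)  ≡⟨ *-left-comm (cartan j v) (cartan j u) (∣αⱼ∣² j) ⟩
    cartan j u ℤ.* (cartan j v ℤ.* ∣αⱼ∣² j)  ≡⟨ cong (cartan j u ℤ.*_) (cartan-exact j v) ⟩
    cartan j u ℤ.* (+ 2 ℤ.* ⟪ v , e j ⟫)     ≡⟨ *-left-comm (cartan j u) (+ 2) ⟪ v , e j ⟫ ⟩
    + 2 ℤ.* (cartan j u ℤ.* ⟪ v , e j ⟫)     ∎)

  σ-isometry : ∀ j u v → ⟪ σ R j u , σ R j v ⟫ ≡ ⟪ u , v ⟫
  σ-isometry j u v = begin
    ⟪ σ R j u , σ R j v ⟫                                            ≡⟨ ⟪σ⟫ˡ j u (σ R j v) ⟩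
    ⟪ u , σ R j v ⟫ ℤ.- cartan j u ℤ.* ⟪ e j , σ R j v ⟫             ≡⟨ cong₂ (λ x y → x ℤ.- cartan j u ℤ.* y) (trans (⟪⟫-sym u (σ R j v)) (⟪σ⟫ˡ j v u))
                                                                           (trans (⟪⟫-sym (e j) (σ R j v)) (⟪σ,αⱼ⟫ j v)) ⟩
    ⟪ v , u ⟫ ℤ.- cartan j v ℤ.* ⟪ e j , u ⟫ ℤ.- cartan j u ℤ.* ℤ.- ⟪ v , e j ⟫
      ≡⟨ cong₂ (λ x y → ⟪ v , u ⟫ ℤ.- cartan j v ℤ.* x ℤ.- cartan j u ℤ.* ℤ.- y) (⟪⟫-sym (e j) u) refl ⟩
    ⟪ v , u ⟫ ℤ.- cartan j v ℤ.* ⟪ u , e j ⟫ ℤ.- cartan j u ℤ.* ℤ.- ⟪ v , e j ⟫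
      ≡⟨ cong (λ x → ⟪ v , u ⟫ ℤ.- x ℤ.- cartan j u ℤ.* ℤ.- ⟪ v , e j ⟫) (cartan-swap j u v) ⟩
    ⟪ v , u ⟫ ℤ.- cartan j u ℤ.* ⟪ v , e j ⟫ ℤ.- cartan j u ℤ.* ℤ.- ⟪ v , e j ⟫
      ≡⟨ cancel ⟪ v , u ⟫ (cartan j u) ⟪ v , e j ⟫ ⟩
    ⟪ v , u ⟫                                                        ≡⟨ ⟪⟫-sym v u ⟩
    ⟪ u , v ⟫                                                        ∎
    where
      cancel : ∀ x c y → x ℤ.- c ℤ.* y ℤ.- c ℤ.* ℤ.- y ≡ x
      cancel = solve-∀

  m2-σ : ∀ j β → m2 R (σ R j β) ≡ m2 R β
  m2-σ j β = cong (λ z → does ((ℤ.∣ z ∣ ℕD./ 2) ℕD.% 2 ℕ.≟ 1)) (σ-isometry j β β)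

module SignedMonomials {k : ℕ} where
  open IntegerParity
  open Lattice

  SignedMonomial : Set
  SignedMonomial = Bool × Lat k

  infixl 7 _⊙_
  infixr 8 _^ₘ_

  _⊙_ : SignedMonomial → SignedMonomial → SignedMonomial
  (s , μ) ⊙ (t , ν) = (s xor t , μ +L ν)

  1ₘ : SignedMonomial
  1ₘ = (false , 0L)

  _^ₘ_ : SignedMonomial → ℤ → SignedMonomial
  (s , μ) ^ₘ a = (s ∧ isOdd a , a ·L μ)

  flipSign : Bool → SignedMonomial → SignedMonomial
  flipSign b (s , μ) = (b xor s , μ)

  ⊙-assoc : ∀ x y z → (x ⊙ y) ⊙ z ≡ x ⊙ (y ⊙ z)
  ⊙-assoc (s , μ) (t , ν) (r , ρ) = cong₂ _,_ (BoolP.xor-assoc s t r) (+L-assoc μ ν ρ)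

  ⊙-comm : ∀ x y → x ⊙ y ≡ y ⊙ x
  ⊙-comm (s , μ) (t , ν) = cong₂ _,_ (BoolP.xor-comm s t) (+L-comm μ ν)

  ⊙-identityˡ : ∀ x → 1ₘ ⊙ x ≡ x
  ⊙-identityˡ (s , μ) = cong (s ,_) (+L-identityˡ μ)

  ⊙-identityʳ : ∀ x → x ⊙ 1ₘ ≡ x
  ⊙-identityʳ x = trans (⊙-comm x 1ₘ) (⊙-identityˡ x)

  ⊙-middle-four : ∀ x y z w → (x ⊙ y) ⊙ (z ⊙ w) ≡ (x ⊙ z) ⊙ (y ⊙ w)
  ⊙-middle-four = comm∧assoc⇒middleFour ⊙-comm ⊙-assoc

  ^ₘ-+ : ∀ x a b → x ^ₘ (a ℤ.+ b) ≡ x ^ₘ a ⊙ x ^ₘ b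
  ^ₘ-+ (s , μ) a b = cong₂ _,_ (trans (cong (s ∧_) (isOdd-+ a b)) (BoolP.∧-distribˡ-xor s (isOdd a) (isOdd b)))
                               (·L-distribʳ a b μ)

  ^ₘ-* : ∀ x a b → (x ^ₘ a) ^ₘ b ≡ x ^ₘ (b ℤ.* a)
  ^ₘ-* (s , μ) a b = cong₂ _,_ (trans (BoolP.∧-assoc s (isOdd a) (isOdd b))
                                      (cong (s ∧_) (trans (BoolP.∧-comm (isOdd a) (isOdd b)) (sym (isOdd-* b a)))))
                               (·L-assoc b a μ)

  ⊙-^ₘ : ∀ x y a → (x ⊙ y) ^ₘ a ≡ x ^ₘ a ⊙ y ^ₘ a
  ⊙-^ₘ (s , μ) (t , ν) a = cong₂ _,_ (BoolP.∧-distribʳ-xor (isOdd a) s t) (·L-distribˡ a μ ν)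

  1ₘ-^ₘ : ∀ a → 1ₘ ^ₘ a ≡ 1ₘ
  1ₘ-^ₘ a = cong (false ,_) (·L-zeroʳ a)

  ^ₘ-0 : ∀ x → x ^ₘ (+ 0) ≡ 1ₘ
  ^ₘ-0 (s , μ) = cong₂ _,_ (BoolP.∧-zeroʳ s) (·L-zeroˡ μ)

  ^ₘ-1 : ∀ x → x ^ₘ (+ 1) ≡ x
  ^ₘ-1 (s , μ) = cong₂ _,_ (BoolP.∧-identityʳ s) (·L-identity μ)

  infixr 8 _^_

  _^_ : ∀ {m} → Vec SignedMonomial m → Lat m → SignedMonomial
  y ^ v = Vec.foldr _ _⊙_ 1ₘ (zipWith _^ₘ_ y v)

  ^-+ : ∀ {m} (y : Vec SignedMonomial m) u v → y ^ (u +L v) ≡ y ^ u ⊙ y ^ v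
  ^-+ []       []       []       = sym (⊙-identityˡ 1ₘ)
  ^-+ (x ∷ y) (a ∷ u) (b ∷ v) =
    trans (cong₂ _⊙_ (^ₘ-+ x a b) (^-+ y u v)) (⊙-middle-four (x ^ₘ a) (x ^ₘ b) (y ^ u) (y ^ v))

  ^-· : ∀ {m} (y : Vec SignedMonomial m) a v → y ^ (a ·L v) ≡ (y ^ v) ^ₘ a
  ^-· []      a []      = sym (1ₘ-^ₘ a)
  ^-· (x ∷ y) a (b ∷ v) =
    trans (cong₂ _⊙_ (sym (^ₘ-* x b a)) (^-· y a v)) (sym (⊙-^ₘ (x ^ₘ b) (y ^ v) a))

  ^-0 : ∀ {m} (y : Vec SignedMonomial m) → y ^ 0L ≡ 1ₘ
  ^-0 []      = refl
  ^-0 (x ∷ y) = trans (cong₂ _⊙_ (^ₘ-0 x) (^-0 y)) (⊙-identityˡ 1ₘ)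

  ^-e : ∀ {m} (y : Vec SignedMonomial m) i → y ^ e i ≡ lookup y i
  ^-e (x ∷ y) zero    = trans (cong (_^_ (x ∷ y)) e-zero) (trans (cong₂ _⊙_ (^ₘ-1 x) (^-0 y)) (⊙-identityʳ x))
  ^-e (x ∷ y) (suc i) = trans (cong₂ _⊙_ (^ₘ-0 x) (^-e y i)) (⊙-identityˡ (lookup y i))

  record IsCharacter {m} (H : Lat m → SignedMonomial) : Set where
    field
      homo-+ : ∀ u v → H (u +L v) ≡ H u ⊙ H v
      homo-· : ∀ a v → H (a ·L v) ≡ H v ^ₘ a

  character-unique : ∀ {m} (H : Lat m → SignedMonomial) → IsCharacter H → ∀ v → tabulate (H ∘ e) ^ v ≡ H v
  character-unique H isChar = lattice-induction (λ v → tabulate (H ∘ e) ^ v ≡ H v)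
    (trans (^-0 (tabulate (H ∘ e))) (sym H0))
    (λ i → trans (^-e (tabulate (H ∘ e)) i) (VecP.lookup∘tabulate (H ∘ e) i))
    (λ u v eu ev → trans (^-+ (tabulate (H ∘ e)) u v) (trans (cong₂ _⊙_ eu ev) (sym (homo-+ u v))))
    (λ a v ev → trans (^-· (tabulate (H ∘ e)) a v) (trans (cong (_^ₘ a) ev) (sym (homo-· a v))))
    where
      open IsCharacter isChar
      H0 : H 0L ≡ 1ₘ
      H0 = trans (cong H (sym (·L-zeroˡ 0L))) (trans (homo-· (+ 0) 0L) (^ₘ-0 (H 0L)))

module Points (R : RootSystem) where
  open RootSystem R
  open Lattice
  open Reflections R
  open SignedMonomials {rank}
  open IntegerParity

  w⁻¹-+ : ∀ ws u v → actWinv R ws (u +L v) ≡ actWinv R ws u +L actWinv R ws v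
  w⁻¹-+ []       u v = refl
  w⁻¹-+ (j ∷ ws) u v = trans (cong (σ R j) (w⁻¹-+ ws u v)) (σ-+ j _ _)

  w⁻¹-· : ∀ ws a v → actWinv R ws (a ·L v) ≡ a ·L actWinv R ws v
  w⁻¹-· []       a v = refl
  w⁻¹-· (j ∷ ws) a v = trans (cong (σ R j) (w⁻¹-· ws a v)) (σ-· j a _)

  w⁻¹-injective : ∀ ws {u v} → actWinv R ws u ≡ actWinv R ws v → u ≡ v
  w⁻¹-injective []       eq = eq
  w⁻¹-injective (j ∷ ws) eq = w⁻¹-injective ws (σ-injective j eq)

  wPt-^ : ∀ ws (y : Point R) v → wPt R ws y ^ v ≡ y ^ actWinv R ws v
  wPt-^ ws y = character-unique (λ v → y ^ actWinv R ws v) (record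
    { homo-+ = λ u v → trans (cong (y ^_) (w⁻¹-+ ws u v)) (^-+ y _ _)
    ; homo-· = λ a v → trans (cong (y ^_) (w⁻¹-· ws a v)) (^-· y a _) })

  xPt-^ : ∀ v → xPt R ^ v ≡ (false , v)
  xPt-^ = character-unique (false ,_) (record { homo-+ = λ _ _ → refl ; homo-· = λ _ _ → refl })

  epsPt-^ : ∀ μ (y : Point R) v → epsPt R μ y ^ v ≡ flipSign (isOdd ⟪ v , μ ⟫) (y ^ v)
  epsPt-^ μ y v = trans (cong (_^ v) (VecP.tabulate-cong (λ i → cong (flipSign (isOdd ⟪ e i , μ ⟫)) (sym (^-e y i)))))
                        (character-unique H (record { homo-+ = homo-+ ; homo-· = homo-· }) v)
    where
      H : Lat rank → SignedMonomial
      H v = flipSign (isOdd ⟪ v , μ ⟫) (y ^ v)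
      homo-+ : ∀ u v → H (u +L v) ≡ H u ⊙ H v
      homo-+ u v = cong₂ _,_
        (trans (cong₂ _xor_ (trans (cong isOdd (⟪⟫-+ˡ u v μ)) (isOdd-+ ⟪ u , μ ⟫ ⟪ v , μ ⟫)) (cong proj₁ (^-+ y u v)))
               (comm∧assoc⇒middleFour BoolP.xor-comm BoolP.xor-assoc
                  (isOdd ⟪ u , μ ⟫) (isOdd ⟪ v , μ ⟫) (proj₁ (y ^ u)) (proj₁ (y ^ v))))
        (cong proj₂ (^-+ y u v))
      homo-· : ∀ a v → H (a ·L v) ≡ H v ^ₘ a
      homo-· a v = cong₂ _,_
        (trans (cong₂ _xor_ (trans (cong isOdd (⟪⟫-·ˡ a v μ)) (isOdd-* a ⟪ v , μ ⟫)) (cong proj₁ (^-· y a v)))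
               (trans (cong (_xor (proj₁ (y ^ v) ∧ isOdd a)) (BoolP.∧-comm (isOdd a) (isOdd ⟪ v , μ ⟫)))
                      (sym (BoolP.∧-distribʳ-xor (isOdd a) (isOdd ⟪ v , μ ⟫) (proj₁ (y ^ v))))))
        (cong proj₂ (^-· y a v))

  pt : Word R → Lat rank → Point R
  pt ws μ = wPt R ws (epsPt R μ (xPt R))

  pt-^ : ∀ ws μ v → pt ws μ ^ v ≡ flipSign (isOdd ⟪ actWinv R ws v , μ ⟫) (false , actWinv R ws v)
  pt-^ ws μ v = trans (wPt-^ ws (epsPt R μ (xPt R)) v)
    (trans (epsPt-^ μ (xPt R) (actWinv R ws v)) (cong (flipSign (isOdd ⟪ actWinv R ws v , μ ⟫)) (xPt-^ (actWinv R ws v))))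


module Substitution (R : RootSystem) where
  open ≡-Reasoning
  open RootSystem R using (rank)
  open LaurentPolynomials (suc rank)
  open SignedMonomials {rank}
  open Points R

  open +-*-Solver using (solve; _:*_; _:=_)

  sign : Bool → ℚ → ℚ
  sign s c = if s then ℚ.- c else c

  infixr 9 _⋆_

  _⋆_ : Point R → SignedMonomial → SignedMonomial
  y ⋆ (s , μ) = flipSign s (y ^ μ)

  sign-* : ∀ s t c d → sign (s xor t) (c ℚ.* d) ≡ sign s c ℚ.* sign t d
  sign-* false false c d = refl
  sign-* false true  c d = ℚP.neg-distribʳ-* c d
  sign-* true  false c d = ℚP.neg-distribˡ-* c d
  sign-* true  true  c d = trans (sym (neg-involutive (c ℚ.* d)))
                                 (trans (cong ℚ.-_ (ℚP.neg-distribʳ-* c d)) (ℚP.neg-distribˡ-* c (ℚ.- d)))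

  sign-neg : ∀ s c → sign s (ℚ.- c) ≡ ℚ.- sign s c
  sign-neg false c = refl
  sign-neg true  c = refl

  sign-sign : ∀ s t c → sign t (sign s c) ≡ sign (s xor t) c
  sign-sign false t     c = refl
  sign-sign true  false c = refl
  sign-sign true  true  c = neg-involutive c

  substTerm-* : ∀ y s t → substTerm R y (proj₁ s ℚ.* proj₁ t , proj₂ s +ₑ proj₂ t)
                        ≡ (proj₁ (substTerm R y s) ℚ.* proj₁ (substTerm R y t) , proj₂ (substTerm R y s) +ₑ proj₂ (substTerm R y t))
  substTerm-* y (c , a ∷ v) (d , b ∷ w) =
    cong (λ x → (sign (proj₁ x) (c ℚ.* d) , (a ℤ.+ b) ∷ proj₂ x)) (^-+ y v w)
    ∙ cong (λ z → (z , (a ℤ.+ b) ∷ (proj₂ (y ^ v) +L proj₂ (y ^ w)))) (sign-* (proj₁ (y ^ v)) (proj₁ (y ^ w)) c d)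
    where _∙_ = trans

  substP-* : ∀ y p q → substP R y (p * q) ≡ substP R y p * substP R y q
  substP-* y []      q = refl
  substP-* y (s ∷ p) q = trans (ListP.map-++ (substTerm R y) _ (p * q)) (cong₂ _++_ (row q) (substP-* y p q))
    where
      row : ∀ q → map (substTerm R y) (map (λ t → (proj₁ s ℚ.* proj₁ t , proj₂ s +ₑ proj₂ t)) q)
                ≡ map (λ t → (proj₁ (substTerm R y s) ℚ.* proj₁ t , proj₂ (substTerm R y s) +ₑ proj₂ t)) (map (substTerm R y) q)
      row []      = refl
      row (t ∷ q) = cong₂ _∷_ (substTerm-* y s t) (row q)

  substP-+ : ∀ y p q → substP R y (p + q) ≡ substP R y p + substP R y q
  substP-+ y = ListP.map-++ (substTerm R y)

  substP-neg : ∀ y p → substP R y (- p) ≡ - substP R y p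
  substP-neg y []                = refl
  substP-neg y ((c , a ∷ v) ∷ p) = cong₂ _∷_ (cong (_, a ∷ proj₂ (y ^ v)) (sign-neg (proj₁ (y ^ v)) c)) (substP-neg y p)

  substP-const : ∀ y c → substP R y (const c) ≡ const c
  substP-const y c = cong (λ x → (sign (proj₁ x) c , + 0 ∷ proj₂ x) ∷ []) (^-0 y)

  substP-u : ∀ y → substP R y (uP R) ≡ uP R
  substP-u y = cong (λ x → (sign (proj₁ x) 1ℚ , + 1 ∷ proj₂ x) ∷ []) (^-0 y)

  substP-mon : ∀ y z → substP R y (monP R z) ≡ monP R (y ⋆ z)
  substP-mon y (s , μ) = cong (λ c → (c , + 0 ∷ proj₂ (y ^ μ)) ∷ []) (sign-sign s (proj₁ (y ^ μ)) 1ℚ)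

  substP-∘ : ∀ z y w → (∀ v → w ^ v ≡ z ⋆ (y ^ v)) → ∀ p → substP R z (substP R y p) ≡ substP R w p
  substP-∘ z y w w≡z⋆y []                = refl
  substP-∘ z y w w≡z⋆y ((c , a ∷ v) ∷ p) = cong₂ _∷_
    (trans (cong (_, a ∷ proj₂ (z ^ proj₂ (y ^ v))) (sign-sign (proj₁ (y ^ v)) (proj₁ (z ^ proj₂ (y ^ v))) c))
           (sym (cong (λ x → (sign (proj₁ x) c , a ∷ proj₂ x)) (w≡z⋆y v))))
    (substP-∘ z y w w≡z⋆y p)

  substP-≗ : ∀ y z → (∀ v → y ^ v ≡ z ^ v) → ∀ p → substP R y p ≡ substP R z p
  substP-≗ y z y≗z []                = refl
  substP-≗ y z y≗z ((c , a ∷ v) ∷ p) = cong₂ _∷_ (cong (λ x → (sign (proj₁ x) c , a ∷ proj₂ x)) (y≗z v)) (substP-≗ y z y≗z p)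

  substP-identity : ∀ y → (∀ v → y ^ v ≡ (false , v)) → ∀ p → substP R y p ≡ p
  substP-identity y y≗x []                = refl
  substP-identity y y≗x ((c , a ∷ v) ∷ p) = cong₂ _∷_ (cong (λ x → (sign (proj₁ x) c , a ∷ proj₂ x)) (y≗x v)) (substP-identity y y≗x p)

  private
    signOf : Point R → Exp → ℚ
    signOf y (a ∷ v) = sign (proj₁ (y ^ v)) 1ℚ

    exponentOf : Point R → Exp → Exp
    exponentOf y (a ∷ v) = a ∷ proj₂ (y ^ v)

    sign≡* : ∀ s c → sign s c ≡ sign s 1ℚ ℚ.* c
    sign≡* false c = sym (ℚP.*-identityˡ c)
    sign≡* true  c = trans (cong ℚ.-_ (sym (ℚP.*-identityˡ c))) (ℚP.neg-distribˡ-* 1ℚ c)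

    signOf≢0 : ∀ y ε → signOf y ε ≢ 0ℚ
    signOf≢0 y (a ∷ v) with proj₁ (y ^ v)
    ... | true  = λ ()
    ... | false = λ ()

  pairing-substP : ∀ h y p → pairing h (substP R y p) ≡ pairing (λ e → signOf y e ℚ.* h (exponentOf y e)) p
  pairing-substP h y []                = refl
  pairing-substP h y ((c , a ∷ v) ∷ p) = cong₂ ℚ._+_
    (trans (cong (ℚ._* h (a ∷ proj₂ (y ^ v))) (sign≡* (proj₁ (y ^ v)) c))
           (solve 3 (λ s c x → (s :* c) :* x := c :* (s :* x)) refl (signOf y (a ∷ v)) c (h (a ∷ proj₂ (y ^ v)))))
    (pairing-substP h y p)

  substP-resp-≈ : ∀ y {p q} → p ≈ q → substP R y p ≈ substP R y q
  substP-resp-≈ y {p} {q} p≈q = coeffwise λ ε → begin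
    coeff (substP R y p) ε                                       ≡⟨ coeff≡pairing-δ (substP R y p) ε ⟩
    pairing (δ ε) (substP R y p)                                 ≡⟨ pairing-substP (δ ε) y p ⟩
    pairing (λ e → signOf y e ℚ.* δ ε (exponentOf y e)) p        ≡⟨ pairing-resp-≈ _ p≈q ⟩
    pairing (λ e → signOf y e ℚ.* δ ε (exponentOf y e)) q        ≡⟨ sym (pairing-substP (δ ε) y q) ⟩
    pairing (δ ε) (substP R y q)                                 ≡⟨ sym (coeff≡pairing-δ (substP R y q) ε) ⟩
    coeff (substP R y q) ε                                       ∎

  -- An injective exponent map relabels the monomials, and each coefficient only changes sign.
  substP-nonzero : ∀ y → (∀ {v w} → proj₂ (y ^ v) ≡ proj₂ (y ^ w) → v ≡ w) →
                   ∀ {p} → ¬ p ≈ 0ₚ → ¬ substP R y p ≈ 0ₚ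
  substP-nonzero y injective {p} p≉0 (coeffwise yp≈0) = p≉0 (coeffwise λ ε →
    decidable-stable (coeff p ε ℚP.≟ 0ℚ) λ c≢0 → p≢0∧q≢0⇒p*q≢0 (signOf≢0 y ε) c≢0 (begin
      signOf y ε ℚ.* coeff p ε                                  ≡⟨ cong (signOf y ε ℚ.*_) (coeff≡pairing-δ p ε) ⟩
      signOf y ε ℚ.* pairing (δ ε) p                            ≡⟨ sym (pairing-scale (signOf y ε) (δ ε) p) ⟩
      pairing (λ e → signOf y ε ℚ.* δ ε e) p                    ≡⟨ pairing-cong p (λ e → sym (relabel ε e)) ⟩
      pairing (λ e → signOf y e ℚ.* δ (exponentOf y ε) (exponentOf y e)) p ≡⟨ sym (pairing-substP (δ (exponentOf y ε)) y p) ⟩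
      pairing (δ (exponentOf y ε)) (substP R y p)               ≡⟨ sym (coeff≡pairing-δ (substP R y p) (exponentOf y ε)) ⟩
      coeff (substP R y p) (exponentOf y ε)                     ≡⟨ yp≈0 (exponentOf y ε) ⟩
      0ℚ                                                        ∎))
    where
      exponentOf-injective : ∀ {e ε} → exponentOf y e ≡ exponentOf y ε → e ≡ ε
      exponentOf-injective {a ∷ v} {b ∷ w} eq = cong₂ _∷_ (VecP.∷-injectiveˡ eq) (injective (VecP.∷-injectiveʳ eq))
      relabel : ∀ ε e → signOf y e ℚ.* δ (exponentOf y ε) (exponentOf y e) ≡ signOf y ε ℚ.* δ ε e
      relabel ε e with e ≟ₑ ε
      ... | yes refl rewrite dec-true (exponentOf y e ≟ₑ exponentOf y e) refl = refl
      ... | no e≢ε   rewrite dec-false (exponentOf y e ≟ₑ exponentOf y ε) (e≢ε ∘ exponentOf-injective) =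
        trans (ℚP.*-zeroʳ (signOf y e)) (sym (ℚP.*-zeroʳ (signOf y ε)))

  ⋆-invM : ∀ y z → y ⋆ invM R z ≡ invM R (y ⋆ z)
  ⋆-invM y (s , μ) = begin
    flipSign s (y ^ (-L μ))                  ≡⟨ cong (λ v → flipSign s (y ^ v)) (Lattice.-L≡-1·L μ) ⟩
    flipSign s (y ^ (ℤ.-1ℤ ·L μ))            ≡⟨ cong (flipSign s) (^-· y ℤ.-1ℤ μ) ⟩
    flipSign s ((y ^ μ) ^ₘ ℤ.-1ℤ)            ≡⟨ cong₂ (λ b v → (s xor b , v)) (BoolP.∧-identityʳ (proj₁ (y ^ μ)))
                                                   (sym (Lattice.-L≡-1·L (proj₂ (y ^ μ)))) ⟩
    invM R (flipSign s (y ^ μ))              ∎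

  ⋆-flipSign : ∀ y d z → y ⋆ flipSign d z ≡ flipSign d (y ⋆ z)
  ⋆-flipSign y d (s , μ) = cong (_, proj₂ (y ^ μ)) (BoolP.xor-assoc d s (proj₁ (y ^ μ)))

  substF-+ : ∀ y f g → substF R y (_+F_ R f g) ≡ _+F_ R (substF R y f) (substF R y g)
  substF-+ y (a , b) (c , d) = cong₂ _,_
    (trans (substP-+ y (a * d) (c * b)) (cong₂ _+_ (substP-* y a d) (substP-* y c b))) (substP-* y b d)

  substF-* : ∀ y f g → substF R y (_*F_ R f g) ≡ _*F_ R (substF R y f) (substF R y g)
  substF-* y (a , b) (c , d) = cong₂ _,_ (substP-* y a c) (substP-* y b d)

  substF-poly : ∀ y p → substF R y (poly R p) ≡ poly R (substP R y p)
  substF-poly y p = cong (substP R y p ,_) (substP-const y 1ℚ)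

  substF-ratio : ∀ y z → substF R y (ratio R z) ≡ ratio R (y ⋆ z)
  substF-ratio y z = cong₂ _,_ (one-minus-u· (invM R z) ∙ cong (λ w → 1ₚ + - (uP R * monP R w)) (⋆-invM y z))
                              (one-minus-u· z)
    where
      _∙_ = trans
      one-minus-u· : ∀ w → substP R y (1ₚ + - (uP R * monP R w)) ≡ 1ₚ + - (uP R * monP R (y ⋆ w))
      one-minus-u· w = substP-+ y 1ₚ _ ∙ cong₂ _+_ (substP-const y 1ℚ)
                         (substP-neg y _ ∙ cong -_ (substP-* y (uP R) (monP R w) ∙ cong₂ _*_ (substP-u y) (substP-mon y w)))

  substF-J : ∀ y z d → substF R y (J R z d) ≡ J R (y ⋆ z) d
  substF-J y z d = begin
    substF R y (_*F_ R (poly R (const ℚ.½)) (_+F_ R (ratio R z) (poly R m)))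
      ≡⟨ substF-* y (poly R (const ℚ.½)) (_+F_ R (ratio R z) (poly R m)) ⟩
    _*F_ R (substF R y (poly R (const ℚ.½))) (substF R y (_+F_ R (ratio R z) (poly R m)))
      ≡⟨ cong₂ (_*F_ R) (trans (substF-poly y (const ℚ.½)) (cong (poly R) (substP-const y ℚ.½)))
                        (trans (substF-+ y (ratio R z) (poly R m)) (cong₂ (_+F_ R) (substF-ratio y z) (trans (substF-poly y m) (cong (poly R) monomial)))) ⟩
    J R (y ⋆ z) d ∎
    where
      m : LPoly R
      m = monP R (flipM R d (invM R z))
      monomial : substP R y m ≡ monP R (flipM R d (invM R (y ⋆ z)))
      monomial = trans (substP-mon y _) (cong (monP R) (trans (⋆-flipSign y d (invM R z)) (cong (flipSign d) (⋆-invM y z))))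


module ListSum (A : CommutativeRing 0ℓ 0ℓ) where
  private module A = CommutativeRing A
  open A using (Carrier; _≈_; _+_; _*_; 0#)
  open SetoidReasoning A.setoid

  ∑ : List Carrier → Carrier
  ∑ = foldr _+_ 0#

  ∑-++ : ∀ xs ys → ∑ (xs ++ ys) ≈ ∑ xs + ∑ ys
  ∑-++ []       ys = A.sym (A.+-identityˡ (∑ ys))
  ∑-++ (x ∷ xs) ys = begin
    x + ∑ (xs ++ ys)        ≈⟨ A.+-congˡ (∑-++ xs ys) ⟩
    x + (∑ xs + ∑ ys)       ≈⟨ A.sym (A.+-assoc x (∑ xs) (∑ ys)) ⟩
    x + ∑ xs + ∑ ys         ∎

  ∑-cong : ∀ {I : Set} (f g : I → Carrier) is → (∀ i → f i ≈ g i) → ∑ (map f is) ≈ ∑ (map g is)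
  ∑-cong f g []       f≈g = A.refl
  ∑-cong f g (i ∷ is) f≈g = A.+-cong (f≈g i) (∑-cong f g is f≈g)

  *-distribˡ-∑ : ∀ a xs → a * ∑ xs ≈ ∑ (map (a *_) xs)
  *-distribˡ-∑ a []       = A.zeroʳ a
  *-distribˡ-∑ a (x ∷ xs) = A.trans (A.distribˡ a x (∑ xs)) (A.+-congˡ (*-distribˡ-∑ a xs))

  ∑-homo : ∀ (h : Carrier → Carrier) → h 0# ≈ 0# → (∀ x y → h (x + y) ≈ h x + h y) →
           ∀ xs → h (∑ xs) ≈ ∑ (map h xs)
  ∑-homo h h0 h+ []       = h0
  ∑-homo h h0 h+ (x ∷ xs) = A.trans (h+ x (∑ xs)) (A.+-congˡ (∑-homo h h0 h+ xs))

module ChintaGunnells (R : RootSystem) where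
  open RootSystem R using (rank; ⟪_,_⟫)
  open LaurentPolynomials (suc rank)
    using (Poly; _≈_; coeffwise; coeff-≡; 0ₑ; _≟ₑ_; 0ₚ; 1ₚ; const)
    renaming (_+_ to _+ₚ_; _*_ to _*ₚ_; -_ to -ₚ_)
  open RationalFunctions (suc rank)
  open SignedMonomials {rank}
  open Points R
  open Substitution R
  open Reflections R
  open IntegerParity

  toFrac : RatFun → Frac R
  toFrac r = (numerator r , denominator r)

  ≡⇒≃ : ∀ {r s} → toFrac r ≡ toFrac s → r ≃ s
  ≡⇒≃ {r} {s} eq = cross (subst (λ f → numerator r *ₚ proj₂ f ≈ proj₁ f *ₚ denominator r) eq ≈-refl)
    where open LaurentPolynomials (suc rank) using (≈-refl)

  ExponentInjective : Point R → Set
  ExponentInjective y = ∀ {v w} → proj₂ (y ^ v) ≡ proj₂ (y ^ w) → v ≡ w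

  substʳ : (y : Point R) → ExponentInjective y → RatFun → RatFun
  substʳ y inj r = substP R y (numerator r) / substP R y (denominator r) ∣ substP-nonzero y inj (denominator≉0 r)

  σx : Fin rank → Point R
  σx j = wPt R (j ∷ []) (xPt R)

  εσx : Fin rank → Point R
  εσx j = epsPt R (e j) (σx j)

  σx-^ : ∀ j v → σx j ^ v ≡ (false , σ R j v)
  σx-^ j v = trans (wPt-^ (j ∷ []) (xPt R) v) (xPt-^ (σ R j v))

  εσx-^ : ∀ j v → εσx j ^ v ≡ flipSign (isOdd ⟪ v , e j ⟫) (false , σ R j v)
  εσx-^ j v = trans (epsPt-^ (e j) (σx j) v) (cong (flipSign (isOdd ⟪ v , e j ⟫)) (σx-^ j v))

  σx-injective : ∀ j → ExponentInjective (σx j)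
  σx-injective j {v} {w} eq = σ-injective j (trans (cong proj₂ (sym (σx-^ j v))) (trans eq (cong proj₂ (σx-^ j w))))

  εσx-injective : ∀ j → ExponentInjective (εσx j)
  εσx-injective j {v} {w} eq = σ-injective j (trans (cong proj₂ (sym (εσx-^ j v))) (trans eq (cong proj₂ (εσx-^ j w))))

  pt-injective : ∀ ws μ → ExponentInjective (pt ws μ)
  pt-injective ws μ {v} {w} eq = w⁻¹-injective ws (trans (cong proj₂ (sym (pt-^ ws μ v))) (trans eq (cong proj₂ (pt-^ ws μ w))))

  at : Word R → Lat rank → RatFun → RatFun
  at ws μ = substʳ (pt ws μ) (pt-injective ws μ)

  ratio-denominator≉0 : ∀ z → ¬ proj₂ (ratio R z) ≈ 0ₚ
  ratio-denominator≉0 (s , μ) (coeffwise den≈0) = ℚP.1≢0 (trans (sym coeff-at-0) (den≈0 0ₑ))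
    where
      open LaurentPolynomials (suc rank) using (coeff)
      u-exponent≢0 : ((+ 1 ℤ.+ + 0) ∷ Vec.zipWith ℤ._+_ 0L μ) ≢ 0ₑ
      u-exponent≢0 eq with VecP.∷-injectiveˡ eq
      ... | ()
      coeff-at-0 : coeff (proj₂ (ratio R (s , μ))) 0ₑ ≡ 1ℚ
      coeff-at-0 rewrite dec-true (0ₑ ≟ₑ 0ₑ) refl | dec-false (_ ≟ₑ 0ₑ) u-exponent≢0 =
        trans (ℚP.+-identityʳ _) (ℚP.+-identityʳ 1ℚ)

  ratioʳ : SignedMonomial → RatFun
  ratioʳ z = proj₁ (ratio R z) / proj₂ (ratio R z) ∣ ratio-denominator≉0 z

  monomialʳ : SignedMonomial → RatFun
  monomialʳ z = polynomial (monP R z)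

  Jʳ : SignedMonomial → Bool → RatFun
  Jʳ z d = constant ℚ.½ * (ratioʳ z + monomialʳ (flipM R d (invM R z)))

  cgσ-cases : Bool → Fin rank → RatFun → RatFun
  cgσ-cases true j r =
    ratioʳ xⱼ * (constant ℚ.½ * (σr + εσr)) + monomialʳ (invM R xⱼ) * (constant ℚ.½ * (σr + constant (ℚ.- 1ℚ) * εσr))
    where
      xⱼ : SignedMonomial
      xⱼ = (false , e j)
      σr εσr : RatFun
      σr = substʳ (σx j) (σx-injective j) r
      εσr = substʳ (εσx j) (εσx-injective j) r
  cgσ-cases false j r = substʳ (σx j) (σx-injective j) r

  cgσʳ : Fin rank → RatFun → RatFun
  cgσʳ j = cgσ-cases (m2j R j) j

  toFrac-cgσʳ : ∀ j r → toFrac (cgσʳ j r) ≡ cgσ R j (toFrac r)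
  toFrac-cgσʳ j r with m2j R j
  ... | true  = refl
  ... | false = refl


  cgσʳ-short : ∀ j r → m2j R j ≡ false → cgσʳ j r ≃ substʳ (σx j) (σx-injective j) r
  cgσʳ-short j r m2≡false = subst (λ b → cgσ-cases b j r ≃ substʳ (σx j) (σx-injective j) r) (sym m2≡false) ≃-refl

  open ℚAlgebraSolver ring constant-homomorphism using (solve; _:+_; _:*_; :-_; _:=_; con)
  private
    module F = CommutativeRing ring
    regroup : ∀ h ρ μ A B → ρ * (h * (A + B)) + μ * (h * (A + (- 1ʳ) * B)) ≃ (h * (ρ + μ)) * A + (h * (ρ + - μ)) * B
    regroup = solve 5 (λ h ρ μ A B → ρ :* (h :* (A :+ B)) :+ μ :* (h :* (A :+ (:- con 1ℚ) :* B))
                                  := (h :* (ρ :+ μ)) :* A :+ (h :* (ρ :+ :- μ)) :* B) F.refl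

  cgσʳ-long : ∀ j r → m2j R j ≡ true →
              cgσʳ j r ≃ Jʳ (false , e j) false * substʳ (σx j) (σx-injective j) r
                       + Jʳ (false , e j) true  * substʳ (εσx j) (εσx-injective j) r
  cgσʳ-long j r m2≡true = subst (λ b → cgσ-cases b j r ≃ decomposition) (sym m2≡true)
    (regroup (constant ℚ.½) (ratioʳ (false , e j)) (monomialʳ (invM R (false , e j)))
             (substʳ (σx j) (σx-injective j) r) (substʳ (εσx j) (εσx-injective j) r))
    where
      decomposition : RatFun
      decomposition = Jʳ (false , e j) false * substʳ (σx j) (σx-injective j) r
                    + Jʳ (false , e j) true  * substʳ (εσx j) (εσx-injective j) r

  substʳ-cong : ∀ y (inj : ExponentInjective y) {r s} → r ≃ s → substʳ y inj r ≃ substʳ y inj s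
  substʳ-cong y inj {a / b ∣ _} {c / d ∣ _} (cross ad≈cb) = cross (begin
    substP R y a *ₚ substP R y d    ≡⟨ sym (substP-* y a d) ⟩
    substP R y (a *ₚ d)             ≈⟨ substP-resp-≈ y ad≈cb ⟩
    substP R y (c *ₚ b)             ≡⟨ substP-* y c b ⟩
    substP R y c *ₚ substP R y b    ∎)
    where open SetoidReasoning (CommutativeRing.setoid (LaurentPolynomials.ring (suc rank)))

  substʳ-+ : ∀ y (inj : ExponentInjective y) r s → substʳ y inj (r + s) ≃ substʳ y inj r + substʳ y inj s
  substʳ-+ y inj r s = ≡⇒≃ (substF-+ y (toFrac r) (toFrac s))

  substʳ-* : ∀ y (inj : ExponentInjective y) r s → substʳ y inj (r * s) ≃ substʳ y inj r * substʳ y inj s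
  substʳ-* y inj r s = ≡⇒≃ (substF-* y (toFrac r) (toFrac s))

  substʳ-0 : ∀ y (inj : ExponentInjective y) → substʳ y inj 0ʳ ≃ 0ʳ
  substʳ-0 y inj = ≡⇒≃ (cong (0ₚ ,_) (substP-const y 1ℚ))

  substʳ-1 : ∀ y (inj : ExponentInjective y) → substʳ y inj 1ʳ ≃ 1ʳ
  substʳ-1 y inj = ≡⇒≃ (cong₂ _,_ (substP-const y 1ℚ) (substP-const y 1ℚ))

  substʳ-≗ : ∀ y z (injy : ExponentInjective y) (injz : ExponentInjective z) → (∀ v → y ^ v ≡ z ^ v) → ∀ r → substʳ y injy r ≃ substʳ z injz r
  substʳ-≗ y z injy injz y≗z r = ≡⇒≃ (cong₂ _,_ (substP-≗ y z y≗z (numerator r)) (substP-≗ y z y≗z (denominator r)))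

  substʳ-∘ : ∀ z y w (injz : ExponentInjective z) (injy : ExponentInjective y) (injw : ExponentInjective w) → (∀ v → w ^ v ≡ z ⋆ (y ^ v)) → ∀ r →
             substʳ z injz (substʳ y injy r) ≃ substʳ w injw r
  substʳ-∘ z y w _ _ _ w≡z⋆y r = ≡⇒≃ (cong₂ _,_ (substP-∘ z y w w≡z⋆y (numerator r)) (substP-∘ z y w w≡z⋆y (denominator r)))

  substʳ-identity : ∀ y (inj : ExponentInjective y) → (∀ v → y ^ v ≡ (false , v)) → ∀ r → substʳ y inj r ≃ r
  substʳ-identity y inj y≗x r = ≡⇒≃ (cong₂ _,_ (substP-identity y y≗x (numerator r)) (substP-identity y y≗x (denominator r)))


module Expansion (R : RootSystem) where
  open RootSystem R using (rank; ⟪_,_⟫)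
  open RationalFunctions (suc rank)
  open ListSum ring
  open SignedMonomials {rank}
  open Points R
  open Substitution R
  open Reflections R
  open ChintaGunnells R
  open IntegerParity
  open Lattice
  private module F = CommutativeRing ring
  open CommutativeSemigroupProperties F.*-commutativeSemigroup using (x∙yz≈y∙xz)

  σx≗pt : ∀ j v → σx j ^ v ≡ pt (j ∷ []) 0L ^ v
  σx≗pt j v = begin
    σx j ^ v                                                      ≡⟨ σx-^ j v ⟩
    (false , σ R j v)                                             ≡⟨ cong (λ z → flipSign (isOdd z) (false , σ R j v)) (sym (⟪⟫-0ʳ (σ R j v))) ⟩
    flipSign (isOdd ⟪ σ R j v , 0L ⟫) (false , σ R j v)           ≡⟨ sym (pt-^ (j ∷ []) 0L v) ⟩
    pt (j ∷ []) 0L ^ v                                            ∎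
    where open ≡-Reasoning

  εσx≗pt : ∀ j v → εσx j ^ v ≡ pt (j ∷ []) (e j) ^ v
  εσx≗pt j v = begin
    εσx j ^ v                                                     ≡⟨ εσx-^ j v ⟩
    flipSign (isOdd ⟪ v , e j ⟫) (false , σ R j v)                ≡⟨ cong (λ b → flipSign b (false , σ R j v)) (sym (trans (cong isOdd (⟪σ,αⱼ⟫ j v)) (isOdd-neg ⟪ v , e j ⟫))) ⟩
    flipSign (isOdd ⟪ σ R j v , e j ⟫) (false , σ R j v)          ≡⟨ sym (pt-^ (j ∷ []) (e j) v) ⟩
    pt (j ∷ []) (e j) ^ v                                         ∎
    where open ≡-Reasoning

  pt-⋆ : ∀ i ν μ u → pt (i ∷ []) ν ⋆ flipSign (isOdd ⟪ u , μ ⟫) (false , u)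
                   ≡ flipSign (isOdd ⟪ σ R i u , ν +L σ R i μ ⟫) (false , σ R i u)
  pt-⋆ i ν μ u = cong₂ _,_ signs (cong proj₂ (pt-^ (i ∷ []) ν u))
    where
      a b : Bool
      a = isOdd ⟪ u , μ ⟫
      b = isOdd ⟪ σ R i u , ν ⟫
      signs : (a xor false) xor proj₁ (pt (i ∷ []) ν ^ u) ≡ isOdd ⟪ σ R i u , ν +L σ R i μ ⟫ xor false
      signs = begin
        (a xor false) xor proj₁ (pt (i ∷ []) ν ^ u)   ≡⟨ cong₂ _xor_ (BoolP.xor-identityʳ a) (cong proj₁ (pt-^ (i ∷ []) ν u)) ⟩
        a xor (b xor false)                            ≡⟨ cong (a xor_) (BoolP.xor-identityʳ b) ⟩
        a xor b                                        ≡⟨ BoolP.xor-comm a b ⟩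
        b xor a                                        ≡⟨ cong (b xor_) (cong isOdd (sym (σ-isometry i u μ))) ⟩
        b xor isOdd ⟪ σ R i u , σ R i μ ⟫             ≡⟨ sym (trans (cong isOdd (⟪⟫-+ʳ (σ R i u) ν (σ R i μ))) (isOdd-+ ⟪ σ R i u , ν ⟫ ⟪ σ R i u , σ R i μ ⟫)) ⟩
        isOdd ⟪ σ R i u , ν +L σ R i μ ⟫              ≡⟨ sym (BoolP.xor-identityʳ (isOdd ⟪ σ R i u , ν +L σ R i μ ⟫)) ⟩
        isOdd ⟪ σ R i u , ν +L σ R i μ ⟫ xor false     ∎
        where open ≡-Reasoning

  pt-∘ : ∀ i ν ws μ v → pt (i ∷ ws) (ν +L σ R i μ) ^ v ≡ pt (i ∷ []) ν ⋆ (pt ws μ ^ v)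
  pt-∘ i ν ws μ v = trans (pt-^ (i ∷ ws) (ν +L σ R i μ) v)
    (trans (sym (pt-⋆ i ν μ (actWinv R ws v))) (cong (pt (i ∷ []) ν ⋆_) (sym (pt-^ ws μ v))))

  at-at : ∀ i ν ws μ r → at (i ∷ []) ν (at ws μ r) ≃ at (i ∷ ws) (ν +L σ R i μ) r
  at-at i ν ws μ = substʳ-∘ (pt (i ∷ []) ν) (pt ws μ) (pt (i ∷ ws) (ν +L σ R i μ))
                            (pt-injective (i ∷ []) ν) (pt-injective ws μ) (pt-injective (i ∷ ws) (ν +L σ R i μ))
                            (pt-∘ i ν ws μ)

  prodJʳ : List (Lat rank) → List Bool → Lat rank → RatFun
  prodJʳ (β ∷ βs) (d ∷ ds) S = Jʳ (flipM R (odd R ⟪ β , S ⟫) (false , β)) d * prodJʳ βs ds (if d then S +L β else S)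
  prodJʳ []       _        S = 1ʳ
  prodJʳ (β ∷ βs) []       S = 1ʳ

  toFrac-prodJʳ : ∀ βs ds S → toFrac (prodJʳ βs ds S) ≡ prodJ R βs ds S
  toFrac-prodJʳ (β ∷ βs) (d ∷ ds) S = cong (_*F_ R (toFrac (Jʳ (flipM R (odd R ⟪ β , S ⟫) (false , β)) d))) (toFrac-prodJʳ βs ds (if d then S +L β else S))
  toFrac-prodJʳ []       ds       S = refl
  toFrac-prodJʳ (β ∷ βs) []       S = refl

  at-prodJʳ : ∀ i ν Ψ δ S → at (i ∷ []) ν (prodJʳ Ψ δ S) ≃ prodJʳ (map (σ R i) Ψ) δ (ν +L σ R i S)
  at-prodJʳ i ν (β ∷ Ψ) (d ∷ δ) S = F.trans (substʳ-* y (pt-injective (i ∷ []) ν) (Jʳ b d) (prodJʳ Ψ δ S′))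
    (F.*-cong (≡⇒≃ {at (i ∷ []) ν (Jʳ b d)} {Jʳ (flipM R (odd R ⟪ σ R i β , ν +L σ R i S ⟫) (false , σ R i β)) d}
                   (trans (substF-J y b d) (cong (λ z → J R z d) (pt-⋆ i ν S β))))
              (F.trans (at-prodJʳ i ν Ψ δ S′) (F.reflexive (cong (prodJʳ (map (σ R i) Ψ) δ) (shift d)))))
    where
      y : Point R
      y = pt (i ∷ []) ν
      b : SignedMonomial
      b = flipM R (odd R ⟪ β , S ⟫) (false , β)
      S′ : Lat rank
      S′ = if d then S +L β else S
      shift : ∀ d → ν +L σ R i (if d then S +L β else S) ≡ (if d then (ν +L σ R i S) +L σ R i β else ν +L σ R i S)
      shift true  = trans (cong (ν +L_) (σ-+ i S β)) (sym (+L-assoc ν (σ R i S) (σ R i β)))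
      shift false = refl
  at-prodJʳ i ν []      δ  S = substʳ-1 (pt (i ∷ []) ν) (pt-injective (i ∷ []) ν)
  at-prodJʳ i ν (β ∷ Ψ) [] S = substʳ-1 (pt (i ∷ []) ν) (pt-injective (i ∷ []) ν)

  epsSum-map-σ : ∀ i Ψ δ → epsSum R (map (σ R i) Ψ) δ ≡ σ R i (epsSum R Ψ δ)
  epsSum-map-σ i []      δ          = sym (σ-0L i)
  epsSum-map-σ i (γ ∷ Ψ) []         = sym (σ-0L i)
  epsSum-map-σ i (γ ∷ Ψ) (true ∷ δ)  = trans (cong (σ R i γ +L_) (epsSum-map-σ i Ψ δ)) (sym (σ-+ i γ (epsSum R Ψ δ)))
  epsSum-map-σ i (γ ∷ Ψ) (false ∷ δ) = epsSum-map-σ i Ψ δ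

  termʳ : Word R → List (Lat rank) → RatFun → List Bool → RatFun
  termʳ ws Φ r δ = at ws (epsSum R Φ δ) r * prodJʳ Φ δ 0L

  at-term : ∀ i ν is Ψ r δ → at (i ∷ []) ν (termʳ is Ψ r δ)
                           ≃ at (i ∷ is) (ν +L epsSum R (map (σ R i) Ψ) δ) r * prodJʳ (map (σ R i) Ψ) δ ν
  at-term i ν is Ψ r δ = F.trans (substʳ-* (pt (i ∷ []) ν) (pt-injective (i ∷ []) ν) (at is (epsSum R Ψ δ) r) (prodJʳ Ψ δ 0L))
    (F.*-cong (F.trans (at-at i ν is (epsSum R Ψ δ) r)
                       (F.reflexive (cong (λ μ → at (i ∷ is) (ν +L μ) r) (sym (epsSum-map-σ i Ψ δ)))))
              (F.trans (at-prodJʳ i ν Ψ δ 0L)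
                       (F.reflexive (cong (prodJʳ (map (σ R i) Ψ) δ) (trans (cong (ν +L_) (σ-0L i)) (+L-identityʳ ν))))))

  m2? : ∀ β → Dec (m2 R β ≡ true)
  m2? β = m2 R β BoolP.≟ true

  filter-m2-map-σ : ∀ i xs → filter m2? (map (σ R i) xs) ≡ map (σ R i) (filter m2? xs)
  filter-m2-map-σ i []       = refl
  filter-m2-map-σ i (x ∷ xs) with m2 R x BoolP.≟ true
  ... | yes m2x  = trans (ListP.filter-accept m2? (trans (m2-σ i x) m2x)) (cong (σ R i x ∷_) (filter-m2-map-σ i xs))
  ... | no  ¬m2x = trans (ListP.filter-reject m2? (¬m2x ∘ trans (sym (m2-σ i x)))) (filter-m2-map-σ i xs)

  PhiSW-∷-long : ∀ i is → m2j R i ≡ true → PhiSW R (i ∷ is) ≡ e i ∷ map (σ R i) (PhiSW R is)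
  PhiSW-∷-long i is m2≡true =
    trans (ListP.filter-accept m2? m2≡true) (cong (e i ∷_) (filter-m2-map-σ i (PhiW R is)))

  PhiSW-∷-short : ∀ i is → m2j R i ≡ false → PhiSW R (i ∷ is) ≡ map (σ R i) (PhiSW R is)
  PhiSW-∷-short i is m2≡false =
    trans (ListP.filter-reject m2? (BoolP.not-¬ m2≡false))
          (filter-m2-map-σ i (PhiW R is))

  rhsʳ : Word R → RatFun → RatFun
  rhsʳ ws r = ∑ (map (termʳ ws (PhiSW R ws) r) (allBools R (length (PhiSW R ws))))

  cgWʳ : Word R → RatFun → RatFun
  cgWʳ ws r = foldr cgσʳ r ws

  toFrac-∑ : ∀ xs → toFrac (∑ xs) ≡ sumF R (map toFrac xs)
  toFrac-∑ []       = refl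
  toFrac-∑ (x ∷ xs) = cong (_+F_ R (toFrac x)) (toFrac-∑ xs)

  toFrac-rhsʳ : ∀ ws r → toFrac (rhsʳ ws r) ≡ rhs R ws (toFrac r)
  toFrac-rhsʳ ws r = trans (toFrac-∑ (map (termʳ ws Φ r) δs))
    (cong (sumF R) (trans (sym (ListP.map-∘ δs))
                          (ListP.map-cong (λ δ → cong (_*F_ R (toFrac (at ws (epsSum R Φ δ) r))) (toFrac-prodJʳ Φ δ 0L)) δs)))
    where
      Φ = PhiSW R ws
      δs = allBools R (length Φ)

  toFrac-cgWʳ : ∀ ws r → toFrac (cgWʳ ws r) ≡ cgW R ws (toFrac r)
  toFrac-cgWʳ []       r = refl
  toFrac-cgWʳ (i ∷ is) r = trans (toFrac-cgσʳ i (cgWʳ is r)) (cong (cgσ R i) (toFrac-cgWʳ is r))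

  rhsʳ-[] : ∀ r → rhsʳ [] r ≃ r
  rhsʳ-[] r = begin
    at [] 0L r * 1ʳ + 0ʳ   ≈⟨ F.+-identityʳ _ ⟩
    at [] 0L r * 1ʳ        ≈⟨ F.*-identityʳ _ ⟩
    at [] 0L r             ≈⟨ substʳ-identity (pt [] 0L) (pt-injective [] 0L) pt-[]-^ r ⟩
    r                      ∎
    where
      open SetoidReasoning F.setoid
      pt-[]-^ : ∀ v → pt [] 0L ^ v ≡ (false , v)
      pt-[]-^ v = trans (pt-^ [] 0L v) (cong (λ z → flipSign (isOdd z) (false , v)) (⟪⟫-0ʳ v))

  at-∑ : ∀ i ν xs → at (i ∷ []) ν (∑ xs) ≃ ∑ (map (at (i ∷ []) ν) xs)
  at-∑ i ν = ∑-homo (at (i ∷ []) ν) (substʳ-0 (pt (i ∷ []) ν) (pt-injective (i ∷ []) ν))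
                    (substʳ-+ (pt (i ∷ []) ν) (pt-injective (i ∷ []) ν))

  ∑-allBools-suc : ∀ k (t : List Bool → RatFun) →
                   ∑ (map t (allBools R (suc k))) ≃ ∑ (map (t ∘ (false ∷_)) (allBools R k)) + ∑ (map (t ∘ (true ∷_)) (allBools R k))
  ∑-allBools-suc k t = F.trans
    (F.reflexive (cong ∑ (trans (ListP.map-++ t (map (false ∷_) δs) (map (true ∷_) δs))
                                (sym (cong₂ _++_ (ListP.map-∘ δs) (ListP.map-∘ δs))))))
    (∑-++ (map (t ∘ (false ∷_)) δs) (map (t ∘ (true ∷_)) δs))
    where δs = allBools R k

  rhsʳ-≡ : ∀ ws Φ r → PhiSW R ws ≡ Φ → rhsʳ ws r ≡ ∑ (map (termʳ ws Φ r) (allBools R (length Φ)))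
  rhsʳ-≡ ws Φ r refl = refl

  module Step (i : Fin rank) (is : Word R) (r : RatFun) where
    Ψ σΨ : List (Lat rank)
    Ψ = PhiSW R is
    σΨ = map (σ R i) Ψ

    δs : List (List Bool)
    δs = allBools R (length Ψ)

    t : List Bool → RatFun
    t = termʳ is Ψ r

    allBools-σΨ : allBools R (length σΨ) ≡ δs
    allBools-σΨ = cong (allBools R) (ListP.length-map (σ R i) Ψ)

    expansion-short : m2j R i ≡ false → cgσʳ i (rhsʳ is r) ≃ rhsʳ (i ∷ is) r
    expansion-short m2≡false = begin
      cgσʳ i (rhsʳ is r)                               ≈⟨ cgσʳ-short i (rhsʳ is r) m2≡false ⟩
      substʳ (σx i) (σx-injective i) (rhsʳ is r)       ≈⟨ substʳ-≗ (σx i) (pt (i ∷ []) 0L) (σx-injective i) (pt-injective (i ∷ []) 0L) (σx≗pt i) (rhsʳ is r) ⟩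
      at (i ∷ []) 0L (∑ (map t δs))                    ≈⟨ at-∑ i 0L (map t δs) ⟩
      ∑ (map (at (i ∷ []) 0L) (map t δs))              ≡⟨ cong ∑ (sym (ListP.map-∘ δs)) ⟩
      ∑ (map (at (i ∷ []) 0L ∘ t) δs)                  ≈⟨ ∑-cong (at (i ∷ []) 0L ∘ t) (termʳ (i ∷ is) σΨ r) δs shifted ⟩
      ∑ (map (termʳ (i ∷ is) σΨ r) δs)                 ≡⟨ cong (λ δs → ∑ (map (termʳ (i ∷ is) σΨ r) δs)) (sym allBools-σΨ) ⟩
      ∑ (map (termʳ (i ∷ is) σΨ r) (allBools R (length σΨ))) ≡⟨ sym (rhsʳ-≡ (i ∷ is) σΨ r (PhiSW-∷-short i is m2≡false)) ⟩
      rhsʳ (i ∷ is) r                                  ∎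
      where
        open SetoidReasoning F.setoid
        shifted : ∀ δ → at (i ∷ []) 0L (t δ) ≃ termʳ (i ∷ is) σΨ r δ
        shifted δ = F.trans (at-term i 0L is Ψ r δ)
          (F.reflexive (cong (λ μ → at (i ∷ is) μ r * prodJʳ σΨ δ 0L) (+L-identityˡ (epsSum R σΨ δ))))

    xᵢ : SignedMonomial
    xᵢ = (false , e i)

    shift : Bool → Lat rank
    shift d = if d then e i else 0L

    t′ : List Bool → RatFun
    t′ = termʳ (i ∷ is) (e i ∷ σΨ) r

    branch-term : ∀ d δ → Jʳ xᵢ d * at (i ∷ []) (shift d) (t δ) ≃ t′ (d ∷ δ)
    branch-term d δ = begin
      Jʳ xᵢ d * at (i ∷ []) (shift d) (t δ)
        ≈⟨ F.*-congˡ {Jʳ xᵢ d} (at-term i (shift d) is Ψ r δ) ⟩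
      Jʳ xᵢ d * (at (i ∷ is) (shift d +L epsSum R σΨ δ) r * prodJʳ σΨ δ (shift d))
        ≈⟨ x∙yz≈y∙xz (Jʳ xᵢ d) (at (i ∷ is) (shift d +L epsSum R σΨ δ) r) (prodJʳ σΨ δ (shift d)) ⟩
      at (i ∷ is) (shift d +L epsSum R σΨ δ) r * (Jʳ xᵢ d * prodJʳ σΨ δ (shift d))
        ≡⟨ cong₂ (λ μ S → at (i ∷ is) μ r * (Jʳ xᵢ d * prodJʳ σΨ δ S)) (shift-eps d) (shift-S d) ⟩
      at (i ∷ is) (epsSum R (e i ∷ σΨ) (d ∷ δ)) r * (Jʳ xᵢ d * prodJʳ σΨ δ (if d then 0L +L e i else 0L))
        ≡⟨ cong (λ z → at (i ∷ is) (epsSum R (e i ∷ σΨ) (d ∷ δ)) r * (Jʳ (flipM R (odd R z) (false , e i)) d * prodJʳ σΨ δ (if d then 0L +L e i else 0L)))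
                (sym (⟪⟫-0ʳ (e i))) ⟩
      t′ (d ∷ δ) ∎
      where
        open SetoidReasoning F.setoid
        shift-eps : ∀ d → shift d +L epsSum R σΨ δ ≡ epsSum R (e i ∷ σΨ) (d ∷ δ)
        shift-eps true  = refl
        shift-eps false = +L-identityˡ (epsSum R σΨ δ)
        shift-S : ∀ d → shift d ≡ (if d then 0L +L e i else 0L)
        shift-S true  = sym (+L-identityˡ (e i))
        shift-S false = refl

    branch : ∀ d → Jʳ xᵢ d * at (i ∷ []) (shift d) (∑ (map t δs)) ≃ ∑ (map (t′ ∘ (d ∷_)) δs)
    branch d = begin
      Jʳ xᵢ d * at (i ∷ []) (shift d) (∑ (map t δs))                   ≈⟨ F.*-congˡ {Jʳ xᵢ d} (at-∑ i (shift d) (map t δs)) ⟩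
      Jʳ xᵢ d * ∑ (map (at (i ∷ []) (shift d)) (map t δs))             ≈⟨ *-distribˡ-∑ (Jʳ xᵢ d) (map (at (i ∷ []) (shift d)) (map t δs)) ⟩
      ∑ (map (Jʳ xᵢ d *_) (map (at (i ∷ []) (shift d)) (map t δs)))    ≡⟨ cong ∑ (sym (trans (ListP.map-∘ δs) (cong (map (Jʳ xᵢ d *_)) (ListP.map-∘ δs)))) ⟩
      ∑ (map (λ δ → Jʳ xᵢ d * at (i ∷ []) (shift d) (t δ)) δs)         ≈⟨ ∑-cong (λ δ → Jʳ xᵢ d * at (i ∷ []) (shift d) (t δ)) (t′ ∘ (d ∷_)) δs (branch-term d) ⟩
      ∑ (map (t′ ∘ (d ∷_)) δs)                                        ∎
      where open SetoidReasoning F.setoid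

    expansion-long : m2j R i ≡ true → cgσʳ i (rhsʳ is r) ≃ rhsʳ (i ∷ is) r
    expansion-long m2≡true = begin
      cgσʳ i (rhsʳ is r)
        ≈⟨ cgσʳ-long i (rhsʳ is r) m2≡true ⟩
      Jʳ xᵢ false * substʳ (σx i) (σx-injective i) (rhsʳ is r) + Jʳ xᵢ true * substʳ (εσx i) (εσx-injective i) (rhsʳ is r)
        ≈⟨ F.+-cong (F.*-congˡ {Jʳ xᵢ false} (substʳ-≗ (σx i) (pt (i ∷ []) 0L) (σx-injective i) (pt-injective (i ∷ []) 0L) (σx≗pt i) (rhsʳ is r)))
                    (F.*-congˡ {Jʳ xᵢ true} (substʳ-≗ (εσx i) (pt (i ∷ []) (e i)) (εσx-injective i) (pt-injective (i ∷ []) (e i)) (εσx≗pt i) (rhsʳ is r))) ⟩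
      Jʳ xᵢ false * at (i ∷ []) 0L (∑ (map t δs)) + Jʳ xᵢ true * at (i ∷ []) (e i) (∑ (map t δs))
        ≈⟨ F.+-cong (branch false) (branch true) ⟩
      ∑ (map (t′ ∘ (false ∷_)) δs) + ∑ (map (t′ ∘ (true ∷_)) δs)
        ≈⟨ F.sym (∑-allBools-suc (length Ψ) t′) ⟩
      ∑ (map t′ (allBools R (suc (length Ψ))))
        ≡⟨ cong (λ δs → ∑ (map t′ (allBools R (suc δs)))) (sym (ListP.length-map (σ R i) Ψ)) ⟩
      ∑ (map t′ (allBools R (length (e i ∷ σΨ))))
        ≡⟨ sym (rhsʳ-≡ (i ∷ is) (e i ∷ σΨ) r (PhiSW-∷-long i is m2≡true)) ⟩
      rhsʳ (i ∷ is) r ∎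
      where open SetoidReasoning F.setoid

  expansion-step : ∀ i is r → cgσʳ i (rhsʳ is r) ≃ rhsʳ (i ∷ is) r
  expansion-step i is r = by-m2 (m2j R i) refl
    where
      by-m2 : ∀ b → m2j R i ≡ b → cgσʳ i (rhsʳ is r) ≃ rhsʳ (i ∷ is) r
      by-m2 true  m2≡true  = Step.expansion-long i is r m2≡true
      by-m2 false m2≡false = Step.expansion-short i is r m2≡false

  cgσʳ-cong : ∀ j {r s} → r ≃ s → cgσʳ j r ≃ cgσʳ j s
  cgσʳ-cong j = by-cases (m2j R j)
    where
      by-cases : ∀ b {r s} → r ≃ s → cgσ-cases b j r ≃ cgσ-cases b j s
      by-cases true {r} {s} r≃s = F.+-cong
          (F.*-congˡ {ratioʳ xⱼ} (F.*-congˡ {½} (F.+-cong σ≃ εσ≃)))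
          (F.*-congˡ {monomialʳ (invM R xⱼ)} (F.*-congˡ {½} (F.+-cong σ≃ (F.*-congˡ {constant (ℚ.- 1ℚ)} εσ≃))))
        where
          xⱼ : SignedMonomial
          xⱼ = (false , e j)
          ½ : RatFun
          ½ = constant ℚ.½
          σ≃ : substʳ (σx j) (σx-injective j) r ≃ substʳ (σx j) (σx-injective j) s
          σ≃ = substʳ-cong (σx j) (σx-injective j) r≃s
          εσ≃ : substʳ (εσx j) (εσx-injective j) r ≃ substʳ (εσx j) (εσx-injective j) s
          εσ≃ = substʳ-cong (εσx j) (εσx-injective j) r≃s
      by-cases false r≃s = substʳ-cong (σx j) (σx-injective j) r≃s

  cgWʳ≃rhsʳ : ∀ ws r → cgWʳ ws r ≃ rhsʳ ws r
  cgWʳ≃rhsʳ []       r = F.sym (rhsʳ-[] r)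
  cgWʳ≃rhsʳ (i ∷ is) r = F.trans (cgσʳ-cong i (cgWʳ≃rhsʳ is r)) (expansion-step i is r)

mainTheorem11 : (R : RootSystem) (ws : List (Fin (RootSystem.rank R))) →
                Reduced R ws →
                (f : Frac R) → ¬ (_≈P_ R (den R f) (0P R)) →
                _≈F_ R (cgW R ws f) (rhs R ws f)
-- The expansion holds for every word.
mainTheorem11 R ws _ f den≉0 =
  subst₂ (_≈F_ R) (toFrac-cgWʳ ws r) (toFrac-rhsʳ ws r) (coeff-≡ (cross-≈ (cgWʳ≃rhsʳ ws r)))
  where
    open RootSystem R using (rank)
    open LaurentPolynomials (suc rank) using (coeffwise; coeff-≡)
    open RationalFunctions (suc rank)
    open Expansion R
    open ChintaGunnells R using (toFrac)
    r : RatFun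
    r = proj₁ f / proj₂ f ∣ λ (coeffwise den≈0) → den≉0 den≈0
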